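{- Let $p$ be an odd prime and $m\in\mathbb{Z}_{(p)}$ with $m\not\equiv 0\pmod p$. Then $$\sum_{k=0}^{\frac{p-1}2}\frac{\binom{2k}k^3}{m^k}\equiv P_{\frac{p-1}2}\Big(\sqrt{1-\frac{64}m}\Big)^2\pmod{p^2}.$$
   Context: $\mathbb{Z}_{(p)}$ is the set of rationals with denominator coprime to $p$. The Legendre polynomials are $P_0(x)=1$, $P_1(x)=x$, $(n+1)P_{n+1}(x)=(2n+1)xP_n(x)-nP_{n-1}(x)$; equivalently $P_n(x)=2^{ -n}\sum_{k=0}^{[n/2]}\binom nk(-1)^k\binom{2n-2k}{n}x^{n-2k}$, with $[x]$ the floor. Since $P_n(x)^2$ is a polynomial in $x^2$ with rational coefficients, $P_n(\sqrt u)^2$ is a rational number for rational $u$ (independent of the choice of square root), and the congruence is between elements of $\mathbb{Z}_{(p)}$. -}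

module Defs where

open import Data.Nat as ℕ using (ℕ; zero; suc; _∸_; _%_)
open import Data.Nat.Combinatorics using (_C_)
open import Data.Nat.Coprimality using (Coprime)
open import Data.Integer as ℤ using (ℤ)
open import Data.Rational as ℚ using (ℚ; ↧ₙ_; _+_; _*_; _-_; 0ℚ; 1ℚ; -_)
open import Data.Product using (Σ; _×_)
open import Relation.Binary.PropositionalEquality using (_≡_)

ℕ→ℚ : ℕ → ℚ
ℕ→ℚ n = ℤ.+ n ℚ./ 1

infixr 8 _^ℚ_
_^ℚ_ : ℚ → ℕ → ℚ
q ^ℚ zero  = 1ℚ
q ^ℚ suc n = q * (q ^ℚ n)

sumTo : ℕ → (ℕ → ℚ) → ℚ
sumTo zero    f = f 0
sumTo (suc n) f = sumTo n f + f (suc n)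

-- membership in Z_(p): denominator (in lowest terms) coprime to p
InZp : ℕ → ℚ → Set
InZp p q = Coprime p (↧ₙ q)

CongMod : ℕ → ℕ → ℚ → ℚ → Set
CongMod p e a b = Σ ℚ λ c → InZp p c × (a - b ≡ (ℕ→ℚ p ^ℚ e) * c)

-- Legendre polynomial P_n(x) = 2^{-n} Σ_{k=0}^{[n/2]} C(n,k) (-1)^k C(2n-2k,n) x^{n-2k}.
-- Writing n = 2⌊n/2⌋ + ε (ε = n % 2), P_n(x) = x^ε Q_n(x^2) with
-- Q_n(u) = 2^{-n} Σ_{k=0}^{[n/2]} C(n,k) (-1)^k C(2n-2k,n) u^{[n/2]-k}.
-- Hence P_n(√u)^2 = u^ε Q_n(u)^2 (independent of the square root).
legendreQ : ℕ → ℚ → ℚ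
legendreQ n u =
  (ℚ.1/ (ℕ→ℚ 2)) ^ℚ n *
  sumTo (n ℕ./ 2) (λ k → ((- 1ℚ) ^ℚ k) * ℕ→ℚ (n C k) * ℕ→ℚ ((2 ℕ.* n ∸ 2 ℕ.* k) C n)
                          * (u ^ℚ (n ℕ./ 2 ∸ k)))

legendreSqAtSqrt : ℕ → ℚ → ℚ
legendreSqAtSqrt n u = (u ^ℚ (n % 2)) * (legendreQ n u * legendreQ n u)

-- Write u = 1 − 64/m = 1 + 4t with t = −16/m. Both Pₙ(√u)² and Σ_{k≤n} C(n+k,2k) C(2k,k)² tᵏ satisfy the
-- same third-order recurrence in n (obtained by squaring Bonnet's recurrence, resp. from Zeilberger's
-- certificate) and agree for n ≤ 2, so they are equal. For p = 2n+1 and k ≤ n, induction on k gives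
-- (−16)ᵏ C(n+k,2k) ≡ C(2k,k) (mod p²), because 4(n+k+1)(n−k) = p² − (2k+1)²; hence the k-th terms of the
-- two sums agree modulo p², the difference carrying the p-integral factor C(2k,k)² m⁻ᵏ.
module Submission where

open import Defs
import Data.Nat
open import Data.Nat as ℕ using (ℕ; zero; suc; _!; _∸_; _/_; _%_; s≤s; z≤n)
import Data.Nat.Properties as ℕₚ
open import Data.Nat.DivMod using (m/n≡1+[m∸n]/n; %-congˡ; [m+n]%n≡m%n; /-congˡ; m*n/n≡m; m*n%n≡0; [m+kn]%n≡m%n; m/n≤m)
open import Data.Nat.Divisibility using (_∣_; _∤_; divides; ∣-refl; ∣-trans; ∣1⇒≡1; ∣⇒≤)
open import Data.Nat.Primality using (Prime; prime⇒irreducible; euclidsLemma; ¬prime[1])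
import Data.Nat.Coprimality as Coprime
open import Data.Nat.Combinatorics using (_C_; nCk+nC[k+1]≡[n+1]C[k+1]; k>n⇒nCk≡0; nCk≡nC[n∸k]; nC1≡n)
import Data.Nat.Tactic.RingSolver as ℕ-Solver
import Data.Integer as ℤ
import Data.Integer.Properties as ℤₚ
import Data.Integer.Divisibility.Signed as ℤ∣
open import Data.Integer.GCD using (gcd)
open import Data.Rational as ℚ using (ℚ; mkℚ; _+_; _*_; _-_; -_; 0ℚ; 1ℚ; 1/_; NonZero; ↥_; ↧_; ↧ₙ_)
import Data.Rational.Properties as ℚₚ
import Data.Rational.Unnormalised as ℚᵘ
import Data.Rational.Unnormalised.Properties as ℚᵘₚ
open import Data.Product using (Σ; _×_; _,_; proj₁; proj₂)
open import Data.Sum using (inj₁; inj₂)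
open import Data.Empty using (⊥-elim)
open import Relation.Nullary using (¬_)
open import Relation.Nullary.Decidable using (dec⇒maybe)
open import Relation.Binary.PropositionalEquality hiding (J)
open import Tactic.RingSolver using (solve-∀)
open import Tactic.RingSolver.Core.AlmostCommutativeRing using (AlmostCommutativeRing; fromCommutativeRing)

open ≡-Reasoning

ℚ-ring : AlmostCommutativeRing _ _
ℚ-ring = fromCommutativeRing ℚₚ.+-*-commutativeRing (λ x → dec⇒maybe (0ℚ ℚₚ.≟ x))

ℕ→ℚ-mkℚ : ∀ n → ℕ→ℚ n ≡ mkℚ (ℤ.+ n) 0 (Coprime.sym (Coprime.1-coprimeTo n))
ℕ→ℚ-mkℚ n = ℚₚ.↥p/↧p≡p (mkℚ (ℤ.+ n) 0 (Coprime.sym (Coprime.1-coprimeTo n)))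

ℕ→ℚ-+ : ∀ m n → ℕ→ℚ (m ℕ.+ n) ≡ ℕ→ℚ m + ℕ→ℚ n
ℕ→ℚ-+ m n = begin
  ℤ.+ (m ℕ.+ n) ℚ./ 1                         ≡⟨ cong (ℚ._/ 1) (ℤₚ.pos-+ m n) ⟩
  (ℤ.+ m ℤ.+ ℤ.+ n) ℚ./ 1                     ≡⟨ cong₂ (λ a b → (a ℤ.+ b) ℚ./ 1) (ℤₚ.*-identityʳ (ℤ.+ m)) (ℤₚ.*-identityʳ (ℤ.+ n)) ⟨
  (ℤ.+ m ℤ.* ℤ.+ 1 ℤ.+ ℤ.+ n ℤ.* ℤ.+ 1) ℚ./ 1 ≡⟨ cong₂ _+_ (ℕ→ℚ-mkℚ m) (ℕ→ℚ-mkℚ n) ⟨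
  ℕ→ℚ m + ℕ→ℚ n                               ∎

ℕ→ℚ-* : ∀ m n → ℕ→ℚ (m ℕ.* n) ≡ ℕ→ℚ m * ℕ→ℚ n
ℕ→ℚ-* m n = trans (cong (ℚ._/ 1) (ℤₚ.pos-* m n)) (sym (cong₂ _*_ (ℕ→ℚ-mkℚ m) (ℕ→ℚ-mkℚ n)))

ℕ→ℚ-suc : ∀ n → ℕ→ℚ (suc n) ≡ 1ℚ + ℕ→ℚ n
ℕ→ℚ-suc = ℕ→ℚ-+ 1

ℕ→ℚ-≢0 : ∀ n .{{_ : ℕ.NonZero n}} → ℕ→ℚ n ≢ 0ℚ
ℕ→ℚ-≢0 (suc n) eq with cong ↥_ (trans (sym (ℕ→ℚ-mkℚ (suc n))) eq)
... | ()

*-≢0 : ∀ {x y} → x ≢ 0ℚ → y ≢ 0ℚ → x * y ≢ 0ℚ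
*-≢0 {x} {y} x≢0 y≢0 xy≡0 = y≢0 (begin
    y                ≡⟨ ℚₚ.*-identityˡ y ⟨
    1ℚ * y           ≡⟨ cong (_* y) (ℚₚ.*-inverseˡ x) ⟨
    1/ x * x * y     ≡⟨ ℚₚ.*-assoc (1/ x) x y ⟩
    1/ x * (x * y)   ≡⟨ cong (1/ x *_) xy≡0 ⟩
    1/ x * 0ℚ        ≡⟨ ℚₚ.*-zeroʳ (1/ x) ⟩
    0ℚ               ∎)
  where instance _ = ℚ.≢-nonZero x≢0

*-cancelʳ-≢0 : ∀ {x y} z → z ≢ 0ℚ → x * z ≡ y * z → x ≡ y
*-cancelʳ-≢0 {x} {y} z z≢0 eq = begin
    x                ≡⟨ undo x ⟩
    x * z * 1/ z     ≡⟨ cong (_* 1/ z) eq ⟩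
    y * z * 1/ z     ≡⟨ undo y ⟨
    y                ∎
  where
  instance _ = ℚ.≢-nonZero z≢0
  undo : ∀ w → w ≡ w * z * 1/ z
  undo w = begin
    w                ≡⟨ ℚₚ.*-identityʳ w ⟨
    w * 1ℚ           ≡⟨ cong (w *_) (ℚₚ.*-inverseʳ z) ⟨
    w * (z * 1/ z)   ≡⟨ ℚₚ.*-assoc w z (1/ z) ⟨
    w * z * 1/ z     ∎

^ℚ-distribʳ-* : ∀ x y k → (x * y) ^ℚ k ≡ x ^ℚ k * y ^ℚ k
^ℚ-distribʳ-* x y zero = refl
^ℚ-distribʳ-* x y (suc k) = trans (cong (x * y *_) (^ℚ-distribʳ-* x y k)) (interchange x y (x ^ℚ k) (y ^ℚ k))
  where
  interchange : ∀ a b c d → a * b * (c * d) ≡ a * c * (b * d)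
  interchange = solve-∀ ℚ-ring

sumTo-+ : ∀ n f g → sumTo n (λ k → f k + g k) ≡ sumTo n f + sumTo n g
sumTo-+ zero f g = refl
sumTo-+ (suc n) f g = trans (cong (_+ (f (suc n) + g (suc n))) (sumTo-+ n f g)) (interchange (sumTo n f) (sumTo n g) (f (suc n)) (g (suc n)))
  where
  interchange : ∀ a b c d → a + b + (c + d) ≡ a + c + (b + d)
  interchange = solve-∀ ℚ-ring

sumTo-*ˡ : ∀ n c f → sumTo n (λ k → c * f k) ≡ c * sumTo n f
sumTo-*ˡ zero c f = refl
sumTo-*ˡ (suc n) c f = trans (cong (_+ c * f (suc n)) (sumTo-*ˡ n c f)) (sym (ℚₚ.*-distribˡ-+ c (sumTo n f) (f (suc n))))

sumTo-neg : ∀ n f → sumTo n (λ k → - f k) ≡ - sumTo n f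
sumTo-neg zero f = refl
sumTo-neg (suc n) f = trans (cong (_+ - f (suc n)) (sumTo-neg n f)) (sym (ℚₚ.neg-distrib-+ (sumTo n f) (f (suc n))))

sumTo-cong : ∀ n {f g} → (∀ k → k ℕ.≤ n → f k ≡ g k) → sumTo n f ≡ sumTo n g
sumTo-cong zero f≗g = f≗g 0 z≤n
sumTo-cong (suc n) f≗g = cong₂ _+_ (sumTo-cong n (λ k k≤n → f≗g k (ℕₚ.m≤n⇒m≤1+n k≤n))) (f≗g (suc n) ℕₚ.≤-refl)

sumTo-suc : ∀ n f → sumTo (suc n) f ≡ f 0 + sumTo n (λ k → f (suc k))
sumTo-suc zero f = refl
sumTo-suc (suc n) f = trans (cong (_+ f (suc (suc n))) (sumTo-suc n f)) (ℚₚ.+-assoc (f 0) (sumTo n (λ k → f (suc k))) (f (suc (suc n))))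

sumTo-extend : ∀ n d f → (∀ k → n ℕ.< k → f k ≡ 0ℚ) → sumTo (d ℕ.+ n) f ≡ sumTo n f
sumTo-extend n zero f f>n≡0 = refl
sumTo-extend n (suc d) f f>n≡0 = begin
  sumTo (d ℕ.+ n) f + f (suc d ℕ.+ n) ≡⟨ cong (sumTo (d ℕ.+ n) f +_) (f>n≡0 _ (s≤s (ℕₚ.m≤n+m n d))) ⟩
  sumTo (d ℕ.+ n) f + 0ℚ             ≡⟨ ℚₚ.+-identityʳ _ ⟩
  sumTo (d ℕ.+ n) f                  ≡⟨ sumTo-extend n d f f>n≡0 ⟩
  sumTo n f                          ∎

data EvenOdd : ℕ → Set where
  even : ∀ m → EvenOdd (2 ℕ.* m)
  odd  : ∀ m → EvenOdd (suc (2 ℕ.* m))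

evenOdd : ∀ n → EvenOdd n
evenOdd zero = even 0
evenOdd (suc n) with evenOdd n
... | even m = odd m
... | odd m  = subst EvenOdd (ℕₚ.*-suc 2 m) (even (suc m))

[2+n]/2≡1+n/2 : ∀ n → suc (suc n) / 2 ≡ suc (n / 2)
[2+n]/2≡1+n/2 n = m/n≡1+[m∸n]/n {suc (suc n)} {2} (s≤s (s≤s z≤n))

[2+n]%2≡n%2 : ∀ n → suc (suc n) % 2 ≡ n % 2
[2+n]%2≡n%2 n = trans (%-congˡ (ℕₚ.+-comm 2 n)) ([m+n]%n≡m%n n 2)

2m/2≡m : ∀ m → 2 ℕ.* m / 2 ≡ m
2m/2≡m m = trans (/-congˡ (ℕₚ.*-comm 2 m)) (m*n/n≡m m 2)

[1+2m]/2≡m : ∀ m → suc (2 ℕ.* m) / 2 ≡ m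
[1+2m]/2≡m zero = refl
[1+2m]/2≡m (suc m) = trans (cong (λ x → suc x / 2) (ℕₚ.*-suc 2 m)) (trans ([2+n]/2≡1+n/2 (suc (2 ℕ.* m))) (cong suc ([1+2m]/2≡m m)))

2m%2≡0 : ∀ m → 2 ℕ.* m % 2 ≡ 0
2m%2≡0 m = trans (%-congˡ (ℕₚ.*-comm 2 m)) (m*n%n≡0 m 2)

[1+2m]%2≡1 : ∀ m → suc (2 ℕ.* m) % 2 ≡ 1
[1+2m]%2≡1 m = trans (%-congˡ {o = 2} (cong suc (ℕₚ.*-comm 2 m))) ([m+kn]%n≡m%n 1 m 2)

u^[1+n]%2*u^n%2≡u : ∀ u n → u ^ℚ (suc n % 2) * u ^ℚ (n % 2) ≡ u
u^[1+n]%2*u^n%2≡u u n with evenOdd n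
... | even m = begin
  u ^ℚ (suc (2 ℕ.* m) % 2) * u ^ℚ (2 ℕ.* m % 2) ≡⟨ cong₂ (λ a b → u ^ℚ a * u ^ℚ b) ([1+2m]%2≡1 m) (2m%2≡0 m) ⟩
  u * 1ℚ * 1ℚ                                   ≡⟨ trans (ℚₚ.*-identityʳ (u * 1ℚ)) (ℚₚ.*-identityʳ u) ⟩
  u                                             ∎
... | odd m = begin
  u ^ℚ (suc (suc (2 ℕ.* m)) % 2) * u ^ℚ (suc (2 ℕ.* m) % 2) ≡⟨ cong₂ (λ a b → u ^ℚ a * u ^ℚ b) (trans ([2+n]%2≡n%2 (2 ℕ.* m)) (2m%2≡0 m)) ([1+2m]%2≡1 m) ⟩
  1ℚ * (u * 1ℚ)                                             ≡⟨ trans (ℚₚ.*-identityˡ (u * 1ℚ)) (ℚₚ.*-identityʳ u) ⟩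
  u                                                         ∎

infixl 8 _↓_
_↓_ : ℚ → ℕ → ℚ
x ↓ zero  = 1ℚ
x ↓ suc l = x * (x - 1ℚ) ↓ l

↓-suc : ∀ x l → x ↓ suc l ≡ x ↓ l * (x - ℕ→ℚ l)
↓-suc x zero = x↓1 x
  where
  x↓1 : ∀ x → x * 1ℚ ≡ 1ℚ * (x - 0ℚ)
  x↓1 = solve-∀ ℚ-ring
↓-suc x (suc l) = begin
    x * (x - 1ℚ) ↓ suc l                      ≡⟨ cong (x *_) (↓-suc (x - 1ℚ) l) ⟩
    x * ((x - 1ℚ) ↓ l * (x - 1ℚ - ℕ→ℚ l))     ≡⟨ cong (λ y → x * ((x - 1ℚ) ↓ l * y)) (shift x (ℕ→ℚ l)) ⟩
    x * ((x - 1ℚ) ↓ l * (x - (1ℚ + ℕ→ℚ l)))   ≡⟨ ℚₚ.*-assoc x ((x - 1ℚ) ↓ l) _ ⟨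
    x * (x - 1ℚ) ↓ l * (x - (1ℚ + ℕ→ℚ l))     ≡⟨ cong (λ y → x ↓ suc l * (x - y)) (ℕ→ℚ-suc l) ⟨
    x ↓ suc l * (x - ℕ→ℚ (suc l))             ∎
  where
  shift : ∀ x y → x - 1ℚ - y ≡ x - (1ℚ + y)
  shift = solve-∀ ℚ-ring

↓-+ : ∀ x l d → x ↓ (l ℕ.+ d) ≡ x ↓ l * (x - ℕ→ℚ l) ↓ d
↓-+ x zero d = begin
    x ↓ d                   ≡⟨ cong (_↓ d) (ℚₚ.+-identityʳ x) ⟨
    (x - 0ℚ) ↓ d            ≡⟨ ℚₚ.*-identityˡ _ ⟨
    1ℚ * (x - 0ℚ) ↓ d       ∎
↓-+ x (suc l) d = begin
    x * (x - 1ℚ) ↓ (l ℕ.+ d)                           ≡⟨ cong (x *_) (↓-+ (x - 1ℚ) l d) ⟩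
    x * ((x - 1ℚ) ↓ l * (x - 1ℚ - ℕ→ℚ l) ↓ d)          ≡⟨ ℚₚ.*-assoc x ((x - 1ℚ) ↓ l) _ ⟨
    x ↓ suc l * (x - 1ℚ - ℕ→ℚ l) ↓ d                   ≡⟨ cong (λ y → x ↓ suc l * y ↓ d) (shift x (ℕ→ℚ l)) ⟩
    x ↓ suc l * (x - (1ℚ + ℕ→ℚ l)) ↓ d                 ≡⟨ cong (λ y → x ↓ suc l * (x - y) ↓ d) (ℕ→ℚ-suc l) ⟨
    x ↓ suc l * (x - ℕ→ℚ (suc l)) ↓ d                  ∎
  where
  shift : ∀ x y → x - 1ℚ - y ≡ x - (1ℚ + y)
  shift = solve-∀ ℚ-ring

ℕ→ℚ-suc-1 : ∀ n → ℕ→ℚ (suc n) - 1ℚ ≡ ℕ→ℚ n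
ℕ→ℚ-suc-1 n = trans (cong (_- 1ℚ) (ℕ→ℚ-suc n)) (cancel (ℕ→ℚ n))
  where
  cancel : ∀ y → 1ℚ + y - 1ℚ ≡ y
  cancel = solve-∀ ℚ-ring

C*!≡↓ : ∀ n k → ℕ→ℚ (n C k) * ℕ→ℚ (k !) ≡ ℕ→ℚ n ↓ k
C*!≡↓ n zero = refl
C*!≡↓ zero (suc k) = begin
    ℕ→ℚ (0 C suc k) * ℕ→ℚ (suc k !)   ≡⟨ cong (λ c → ℕ→ℚ c * ℕ→ℚ (suc k !)) (k>n⇒nCk≡0 {0} {suc k} (s≤s z≤n)) ⟩
    0ℚ * ℕ→ℚ (suc k !)                ≡⟨ ℚₚ.*-zeroˡ (ℕ→ℚ (suc k !)) ⟩
    0ℚ                                ≡⟨ ℚₚ.*-zeroˡ ((0ℚ - 1ℚ) ↓ k) ⟨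
    0ℚ * (0ℚ - 1ℚ) ↓ k                ∎
C*!≡↓ (suc n) (suc k) = begin
    ℕ→ℚ (suc n C suc k) * ℕ→ℚ (suc k !)
      ≡⟨ cong₂ _*_ (trans (cong ℕ→ℚ (sym (nCk+nC[k+1]≡[n+1]C[k+1] n k))) (ℕ→ℚ-+ (n C k) (n C suc k))) (ℕ→ℚ-* (suc k) (k !)) ⟩
    (A + B) * (K₁ * F)          ≡⟨ distrib A B K₁ F ⟩
    K₁ * (A * F) + B * (K₁ * F) ≡⟨ cong₂ (λ a b → K₁ * a + b) (C*!≡↓ n k) (trans (cong (B *_) (sym (ℕ→ℚ-* (suc k) (k !)))) (C*!≡↓ n (suc k))) ⟩
    K₁ * N ↓ k + N ↓ suc k      ≡⟨ cong₂ (λ a b → a * N ↓ k + b) (ℕ→ℚ-suc k) (↓-suc N k) ⟩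
    (1ℚ + K) * N ↓ k + N ↓ k * (N - K) ≡⟨ collect K N (N ↓ k) ⟩
    (1ℚ + N) * N ↓ k            ≡⟨ cong₂ (λ a b → a * b ↓ k) (ℕ→ℚ-suc n) (ℕ→ℚ-suc-1 n) ⟨
    ℕ→ℚ (suc n) ↓ suc k         ∎
  where
  A = ℕ→ℚ (n C k)
  B = ℕ→ℚ (n C suc k)
  F = ℕ→ℚ (k !)
  K = ℕ→ℚ k
  K₁ = ℕ→ℚ (suc k)
  N = ℕ→ℚ n
  distrib : ∀ a b k₁ f → (a + b) * (k₁ * f) ≡ k₁ * (a * f) + b * (k₁ * f)
  distrib = solve-∀ ℚ-ring
  collect : ∀ k n x → (1ℚ + k) * x + x * (n - k) ≡ (1ℚ + n) * x
  collect = solve-∀ ℚ-ring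

private
  cancel-! : ∀ {x y} k → x * ℕ→ℚ (k !) ≡ y * ℕ→ℚ (k !) → x ≡ y
  cancel-! k = *-cancelʳ-≢0 (ℕ→ℚ (k !)) (ℕ→ℚ-≢0 (k !) {{ℕₚ._!≢0 k}})

[n+1]C[k+1]*[k+1]≡[n+1]*nCk : ∀ n k → ℕ→ℚ (suc n C suc k) * ℕ→ℚ (suc k) ≡ ℕ→ℚ (suc n) * ℕ→ℚ (n C k)
[n+1]C[k+1]*[k+1]≡[n+1]*nCk n k = cancel-! k (begin
    ℕ→ℚ (suc n C suc k) * ℕ→ℚ (suc k) * ℕ→ℚ (k !)   ≡⟨ ℚₚ.*-assoc (ℕ→ℚ (suc n C suc k)) (ℕ→ℚ (suc k)) (ℕ→ℚ (k !)) ⟩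
    ℕ→ℚ (suc n C suc k) * (ℕ→ℚ (suc k) * ℕ→ℚ (k !)) ≡⟨ cong (ℕ→ℚ (suc n C suc k) *_) (ℕ→ℚ-* (suc k) (k !)) ⟨
    ℕ→ℚ (suc n C suc k) * ℕ→ℚ (suc k !)             ≡⟨ C*!≡↓ (suc n) (suc k) ⟩
    ℕ→ℚ (suc n) * (ℕ→ℚ (suc n) - 1ℚ) ↓ k           ≡⟨ cong (λ x → ℕ→ℚ (suc n) * x ↓ k) (ℕ→ℚ-suc-1 n) ⟩
    ℕ→ℚ (suc n) * ℕ→ℚ n ↓ k                        ≡⟨ cong (ℕ→ℚ (suc n) *_) (C*!≡↓ n k) ⟨
    ℕ→ℚ (suc n) * (ℕ→ℚ (n C k) * ℕ→ℚ (k !))        ≡⟨ ℚₚ.*-assoc (ℕ→ℚ (suc n)) (ℕ→ℚ (n C k)) (ℕ→ℚ (k !)) ⟨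
    ℕ→ℚ (suc n) * ℕ→ℚ (n C k) * ℕ→ℚ (k !)          ∎)

nC[k+1]*[k+1]≡nCk*[n-k] : ∀ n k → ℕ→ℚ (n C suc k) * ℕ→ℚ (suc k) ≡ ℕ→ℚ (n C k) * (ℕ→ℚ n - ℕ→ℚ k)
nC[k+1]*[k+1]≡nCk*[n-k] n k = cancel-! k (begin
    ℕ→ℚ (n C suc k) * ℕ→ℚ (suc k) * ℕ→ℚ (k !)      ≡⟨ ℚₚ.*-assoc (ℕ→ℚ (n C suc k)) (ℕ→ℚ (suc k)) (ℕ→ℚ (k !)) ⟩
    ℕ→ℚ (n C suc k) * (ℕ→ℚ (suc k) * ℕ→ℚ (k !))    ≡⟨ cong (ℕ→ℚ (n C suc k) *_) (ℕ→ℚ-* (suc k) (k !)) ⟨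
    ℕ→ℚ (n C suc k) * ℕ→ℚ (suc k !)                ≡⟨ C*!≡↓ n (suc k) ⟩
    ℕ→ℚ n ↓ suc k                                  ≡⟨ ↓-suc (ℕ→ℚ n) k ⟩
    ℕ→ℚ n ↓ k * (ℕ→ℚ n - ℕ→ℚ k)                    ≡⟨ cong (_* (ℕ→ℚ n - ℕ→ℚ k)) (C*!≡↓ n k) ⟨
    ℕ→ℚ (n C k) * ℕ→ℚ (k !) * (ℕ→ℚ n - ℕ→ℚ k)      ≡⟨ swap (ℕ→ℚ (n C k)) (ℕ→ℚ (k !)) (ℕ→ℚ n - ℕ→ℚ k) ⟩
    ℕ→ℚ (n C k) * (ℕ→ℚ n - ℕ→ℚ k) * ℕ→ℚ (k !)      ∎)
  where
  swap : ∀ a b c → a * b * c ≡ a * c * b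
  swap = solve-∀ ℚ-ring

[2k+2]C[k+1]*[k+1]≡2[2k+1]*[2k]Ck : ∀ k →
  ℕ→ℚ ((2 ℕ.* suc k) C suc k) * ℕ→ℚ (suc k) ≡ ℕ→ℚ 2 * ℕ→ℚ (suc (2 ℕ.* k)) * ℕ→ℚ ((2 ℕ.* k) C k)
[2k+2]C[k+1]*[k+1]≡2[2k+1]*[2k]Ck k = begin
    ℕ→ℚ ((2 ℕ.* suc k) C suc k) * ℕ→ℚ (suc k)              ≡⟨ cong (λ x → ℕ→ℚ (x C suc k) * ℕ→ℚ (suc k)) (ℕₚ.*-suc 2 k) ⟩
    ℕ→ℚ (suc m C suc k) * ℕ→ℚ (suc k)                      ≡⟨ cong (λ c → ℕ→ℚ c * ℕ→ℚ (suc k)) pascal ⟩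
    ℕ→ℚ (2 ℕ.* (m C suc k)) * ℕ→ℚ (suc k)                 ≡⟨ cong (_* ℕ→ℚ (suc k)) (ℕ→ℚ-* 2 (m C suc k)) ⟩
    ℕ→ℚ 2 * ℕ→ℚ (m C suc k) * ℕ→ℚ (suc k)                 ≡⟨ ℚₚ.*-assoc (ℕ→ℚ 2) (ℕ→ℚ (m C suc k)) (ℕ→ℚ (suc k)) ⟩
    ℕ→ℚ 2 * (ℕ→ℚ (m C suc k) * ℕ→ℚ (suc k))               ≡⟨ cong (ℕ→ℚ 2 *_) ([n+1]C[k+1]*[k+1]≡[n+1]*nCk (2 ℕ.* k) k) ⟩
    ℕ→ℚ 2 * (ℕ→ℚ m * ℕ→ℚ ((2 ℕ.* k) C k))                 ≡⟨ ℚₚ.*-assoc (ℕ→ℚ 2) (ℕ→ℚ m) (ℕ→ℚ ((2 ℕ.* k) C k)) ⟨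
    ℕ→ℚ 2 * ℕ→ℚ m * ℕ→ℚ ((2 ℕ.* k) C k)                   ∎
  where
  m = suc (2 ℕ.* k)
  m∸k≡1+k : m ∸ k ≡ suc k
  m∸k≡1+k = trans (cong (_∸ k) (split k)) (ℕₚ.m+n∸m≡n k (suc k))
    where
    split : ∀ k → suc (2 ℕ.* k) ≡ k ℕ.+ suc k
    split = ℕ-Solver.solve-∀
  pascal : suc m C suc k ≡ 2 ℕ.* (m C suc k)
  pascal = begin
    suc m C suc k               ≡⟨ nCk+nC[k+1]≡[n+1]C[k+1] m k ⟨
    m C k ℕ.+ m C suc k         ≡⟨ cong (ℕ._+ m C suc k) (trans (nCk≡nC[n∸k] (ℕₚ.m≤n⇒m≤1+n (ℕₚ.m≤m+n k (k ℕ.+ 0)))) (cong (m C_) m∸k≡1+k)) ⟩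
    m C suc k ℕ.+ m C suc k     ≡⟨ cong (m C suc k ℕ.+_) (ℕₚ.+-identityʳ (m C suc k)) ⟨
    m C suc k ℕ.+ (m C suc k ℕ.+ 0) ∎

[n+k+1]C[2k+2]≡[n+k]C[2k] : ∀ n k →
  ℕ→ℚ ((n ℕ.+ suc k) C (2 ℕ.* suc k)) * (ℕ→ℚ (suc (2 ℕ.* k)) * ℕ→ℚ (2 ℕ.* suc k))
    ≡ ℕ→ℚ ((n ℕ.+ k) C (2 ℕ.* k)) * (ℕ→ℚ (suc (n ℕ.+ k)) * (ℕ→ℚ n - ℕ→ℚ k))
[n+k+1]C[2k+2]≡[n+k]C[2k] n k = begin
    ℕ→ℚ ((n ℕ.+ suc k) C (2 ℕ.* suc k)) * (J₁ * ℕ→ℚ (2 ℕ.* suc k))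
      ≡⟨ cong₂ (λ x y → ℕ→ℚ (x C y) * (J₁ * ℕ→ℚ y)) (ℕₚ.+-suc n k) (ℕₚ.*-suc 2 k) ⟩
    ℕ→ℚ (suc N C suc (suc j)) * (J₁ * J₂)             ≡⟨ swap (ℕ→ℚ (suc N C suc (suc j))) J₁ J₂ ⟩
    ℕ→ℚ (suc N C suc (suc j)) * J₂ * J₁               ≡⟨ cong (_* J₁) ([n+1]C[k+1]*[k+1]≡[n+1]*nCk N (suc j)) ⟩
    ℕ→ℚ (suc N) * ℕ→ℚ (N C suc j) * J₁                ≡⟨ ℚₚ.*-assoc (ℕ→ℚ (suc N)) (ℕ→ℚ (N C suc j)) J₁ ⟩
    ℕ→ℚ (suc N) * (ℕ→ℚ (N C suc j) * J₁)              ≡⟨ cong (ℕ→ℚ (suc N) *_) (nC[k+1]*[k+1]≡nCk*[n-k] N j) ⟩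
    ℕ→ℚ (suc N) * (ℕ→ℚ (N C j) * (ℕ→ℚ N - ℕ→ℚ j))    ≡⟨ cong (λ x → ℕ→ℚ (suc N) * (ℕ→ℚ (N C j) * x)) N-j≡n-k ⟩
    ℕ→ℚ (suc N) * (ℕ→ℚ (N C j) * (ℕ→ℚ n - ℕ→ℚ k))    ≡⟨ swap′ (ℕ→ℚ (suc N)) (ℕ→ℚ (N C j)) (ℕ→ℚ n - ℕ→ℚ k) ⟩
    ℕ→ℚ (N C j) * (ℕ→ℚ (suc N) * (ℕ→ℚ n - ℕ→ℚ k))    ∎
  where
  N = n ℕ.+ k
  j = 2 ℕ.* k
  J₁ = ℕ→ℚ (suc j)
  J₂ = ℕ→ℚ (suc (suc j))
  swap : ∀ c a b → c * (a * b) ≡ c * b * a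
  swap = solve-∀ ℚ-ring
  swap′ : ∀ a b c → a * (b * c) ≡ b * (a * c)
  swap′ = solve-∀ ℚ-ring
  N-j≡n-k : ℕ→ℚ N - ℕ→ℚ j ≡ ℕ→ℚ n - ℕ→ℚ k
  N-j≡n-k = begin
    ℕ→ℚ (n ℕ.+ k) - ℕ→ℚ (2 ℕ.* k)              ≡⟨ cong₂ _-_ (ℕ→ℚ-+ n k) (ℕ→ℚ-* 2 k) ⟩
    ℕ→ℚ n + ℕ→ℚ k - ℕ→ℚ 2 * ℕ→ℚ k              ≡⟨ simplify (ℕ→ℚ n) (ℕ→ℚ k) ⟩
    ℕ→ℚ n - ℕ→ℚ k                              ∎
    where
    simplify : ∀ n k → n + k - ℕ→ℚ 2 * k ≡ n - k
    simplify = solve-∀ ℚ-ring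

[-16]ᵏC[n+k,2k]-step : ∀ n k →
  (- ℕ→ℚ 16) ^ℚ suc k * ℕ→ℚ ((n ℕ.+ suc k) C (2 ℕ.* suc k)) * (ℕ→ℚ (suc (2 ℕ.* k)) * ℕ→ℚ (2 ℕ.* suc k))
    ≡ - ℕ→ℚ 16 * ((1ℚ + (ℕ→ℚ n + ℕ→ℚ k)) * (ℕ→ℚ n - ℕ→ℚ k)) * ((- ℕ→ℚ 16) ^ℚ k * ℕ→ℚ ((n ℕ.+ k) C (2 ℕ.* k)))
[-16]ᵏC[n+k,2k]-step n k = begin
  (- ℕ→ℚ 16) * σ * C₁ * J                       ≡⟨ ℚₚ.*-assoc ((- ℕ→ℚ 16) * σ) C₁ J ⟩
  (- ℕ→ℚ 16) * σ * (C₁ * J)                     ≡⟨ cong ((- ℕ→ℚ 16) * σ *_) ([n+k+1]C[2k+2]≡[n+k]C[2k] n k) ⟩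
  (- ℕ→ℚ 16) * σ * (C₀ * (ℕ→ℚ (suc (n ℕ.+ k)) * (ℕ→ℚ n - ℕ→ℚ k)))
    ≡⟨ cong (λ x → (- ℕ→ℚ 16) * σ * (C₀ * (x * (ℕ→ℚ n - ℕ→ℚ k)))) (trans (ℕ→ℚ-suc (n ℕ.+ k)) (cong (1ℚ +_) (ℕ→ℚ-+ n k))) ⟩
  (- ℕ→ℚ 16) * σ * (C₀ * ((1ℚ + (ℕ→ℚ n + ℕ→ℚ k)) * (ℕ→ℚ n - ℕ→ℚ k)))
    ≡⟨ regroup (- ℕ→ℚ 16) σ C₀ ((1ℚ + (ℕ→ℚ n + ℕ→ℚ k)) * (ℕ→ℚ n - ℕ→ℚ k)) ⟩
  - ℕ→ℚ 16 * ((1ℚ + (ℕ→ℚ n + ℕ→ℚ k)) * (ℕ→ℚ n - ℕ→ℚ k)) * (σ * C₀) ∎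
  where
  σ = (- ℕ→ℚ 16) ^ℚ k
  C₀ = ℕ→ℚ ((n ℕ.+ k) C (2 ℕ.* k))
  C₁ = ℕ→ℚ ((n ℕ.+ suc k) C (2 ℕ.* suc k))
  J = ℕ→ℚ (suc (2 ℕ.* k)) * ℕ→ℚ (2 ℕ.* suc k)
  regroup : ∀ a b c d → a * b * (c * d) ≡ a * d * (b * c)
  regroup = solve-∀ ℚ-ring

C[2k,k]-step : ∀ k →
  ℕ→ℚ ((2 ℕ.* suc k) C suc k) * (ℕ→ℚ (suc (2 ℕ.* k)) * ℕ→ℚ (2 ℕ.* suc k))
    ≡ ℕ→ℚ 4 * (ℕ→ℚ 2 * ℕ→ℚ k + 1ℚ) * (ℕ→ℚ 2 * ℕ→ℚ k + 1ℚ) * ℕ→ℚ ((2 ℕ.* k) C k)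
C[2k,k]-step k = begin
  E′ * (J₁ * ℕ→ℚ (2 ℕ.* suc k))                ≡⟨ cong (λ x → E′ * (J₁ * x)) (ℕ→ℚ-* 2 (suc k)) ⟩
  E′ * (J₁ * (ℕ→ℚ 2 * ℕ→ℚ (suc k)))            ≡⟨ regroup E′ J₁ (ℕ→ℚ 2) (ℕ→ℚ (suc k)) ⟩
  E′ * ℕ→ℚ (suc k) * (ℕ→ℚ 2 * J₁)              ≡⟨ cong (_* (ℕ→ℚ 2 * J₁)) ([2k+2]C[k+1]*[k+1]≡2[2k+1]*[2k]Ck k) ⟩
  ℕ→ℚ 2 * J₁ * E * (ℕ→ℚ 2 * J₁)                ≡⟨ cong (λ j → ℕ→ℚ 2 * j * E * (ℕ→ℚ 2 * j)) J₁≡ ⟩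
  ℕ→ℚ 2 * (ℕ→ℚ 2 * K + 1ℚ) * E * (ℕ→ℚ 2 * (ℕ→ℚ 2 * K + 1ℚ)) ≡⟨ square (ℕ→ℚ 2 * K + 1ℚ) E ⟩
  ℕ→ℚ 4 * (ℕ→ℚ 2 * K + 1ℚ) * (ℕ→ℚ 2 * K + 1ℚ) * E ∎
  where
  K = ℕ→ℚ k
  E = ℕ→ℚ ((2 ℕ.* k) C k)
  E′ = ℕ→ℚ ((2 ℕ.* suc k) C suc k)
  J₁ = ℕ→ℚ (suc (2 ℕ.* k))
  J₁≡ : J₁ ≡ ℕ→ℚ 2 * K + 1ℚ
  J₁≡ = trans (ℕ→ℚ-suc (2 ℕ.* k)) (trans (ℚₚ.+-comm 1ℚ (ℕ→ℚ (2 ℕ.* k))) (cong (_+ 1ℚ) (ℕ→ℚ-* 2 k)))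
  regroup : ∀ e j a b → e * (j * (a * b)) ≡ e * b * (a * j)
  regroup = solve-∀ ℚ-ring
  square : ∀ j e → ℕ→ℚ 2 * j * e * (ℕ→ℚ 2 * j) ≡ ℕ→ℚ 4 * j * j * e
  square = solve-∀ ℚ-ring

-- With p = 2n+1 one has 4(n+k+1)(n−k) = p² − (2k+1)²: the two first-order recurrences differ by a multiple of p².
p²-divides-step : ∀ N K B E B′ E′ W c →
  B′ * W ≡ - ℕ→ℚ 16 * ((1ℚ + (N + K)) * (N - K)) * B →
  E′ * W ≡ ℕ→ℚ 4 * (ℕ→ℚ 2 * K + 1ℚ) * (ℕ→ℚ 2 * K + 1ℚ) * E →
  B - E ≡ (1ℚ + ℕ→ℚ 2 * N) ^ℚ 2 * c →
  B′ * W - E′ * W ≡ (1ℚ + ℕ→ℚ 2 * N) ^ℚ 2 * (ℕ→ℚ 4 * (ℕ→ℚ 2 * K + 1ℚ) * (ℕ→ℚ 2 * K + 1ℚ) * c - ℕ→ℚ 4 * B)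
p²-divides-step N K B E B′ E′ W c hB hE B-E≡P²c = begin
  B′ * W - E′ * W
    ≡⟨ cong₂ _-_ hB hE ⟩
  - ℕ→ℚ 16 * ((1ℚ + (N + K)) * (N - K)) * B - A * E
    ≡⟨ difference-of-squares N K B E ⟩
  A * (B - E) - ℕ→ℚ 4 * P ^ℚ 2 * B
    ≡⟨ cong (λ x → A * x - ℕ→ℚ 4 * P ^ℚ 2 * B) B-E≡P²c ⟩
  A * (P ^ℚ 2 * c) - ℕ→ℚ 4 * P ^ℚ 2 * B
    ≡⟨ factor A (P ^ℚ 2) c B ⟩
  P ^ℚ 2 * (A * c - ℕ→ℚ 4 * B) ∎
  where
  P = 1ℚ + ℕ→ℚ 2 * N
  A = ℕ→ℚ 4 * (ℕ→ℚ 2 * K + 1ℚ) * (ℕ→ℚ 2 * K + 1ℚ)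
  difference-of-squares : ∀ N K B E →
    - ℕ→ℚ 16 * ((1ℚ + (N + K)) * (N - K)) * B - ℕ→ℚ 4 * (ℕ→ℚ 2 * K + 1ℚ) * (ℕ→ℚ 2 * K + 1ℚ) * E
      ≡ ℕ→ℚ 4 * (ℕ→ℚ 2 * K + 1ℚ) * (ℕ→ℚ 2 * K + 1ℚ) * (B - E) - ℕ→ℚ 4 * ((1ℚ + ℕ→ℚ 2 * N) * ((1ℚ + ℕ→ℚ 2 * N) * 1ℚ)) * B
  difference-of-squares = solve-∀ ℚ-ring
  factor : ∀ a q c b → a * (q * c) - ℕ→ℚ 4 * q * b ≡ q * (a * c - ℕ→ℚ 4 * b)
  factor = solve-∀ ℚ-ring

module _ {p : ℕ} (p-prime : Prime p) where

  InZp⇒∤↧ : ∀ q → InZp p q → p ∤ ↧ₙ q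
  InZp⇒∤↧ q coprime p∣↧q = ¬prime[1] (subst Prime (coprime (∣-refl , p∣↧q)) p-prime)

  ∤↧⇒InZp : ∀ q → p ∤ ↧ₙ q → InZp p q
  ∤↧⇒InZp q p∤↧q (d∣p , d∣↧q) with prime⇒irreducible p-prime d∣p
  ... | inj₁ d≡1 = d≡1
  ... | inj₂ refl = ⊥-elim (p∤↧q d∣↧q)

  ∤-* : ∀ {a b} → p ∤ a → p ∤ b → p ∤ a ℕ.* b
  ∤-* {a} {b} p∤a p∤b p∣ab with euclidsLemma a b p-prime p∣ab
  ... | inj₁ p∣a = p∤a p∣a
  ... | inj₂ p∣b = p∤b p∣b

  private
    ∤↧-from-↧-product : ∀ x y z i → ↧ z ℤ.* i ≡ ↧ x ℤ.* ↧ y → p ∤ ↧ₙ x → p ∤ ↧ₙ y → p ∤ ↧ₙ z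
    ∤↧-from-↧-product x y z i eq p∤↧x p∤↧y p∣↧z = ∤-* p∤↧x p∤↧y (∣-trans p∣↧z ↧z∣↧x↧y)
      where
      ↧z∣↧x↧y : ↧ₙ z ∣ ↧ₙ x ℕ.* ↧ₙ y
      ↧z∣↧x↧y = divides ℤ.∣ i ∣ (begin
        ↧ₙ x ℕ.* ↧ₙ y          ≡⟨ ℤₚ.abs-* (↧ x) (↧ y) ⟨
        ℤ.∣ ↧ x ℤ.* ↧ y ∣      ≡⟨ cong ℤ.∣_∣ eq ⟨
        ℤ.∣ ↧ z ℤ.* i ∣        ≡⟨ ℤₚ.abs-* (↧ z) i ⟩
        ↧ₙ z ℕ.* ℤ.∣ i ∣        ≡⟨ ℕₚ.*-comm (↧ₙ z) ℤ.∣ i ∣ ⟩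
        ℤ.∣ i ∣ ℕ.* ↧ₙ z        ∎)

  ∤↧-* : ∀ x y → p ∤ ↧ₙ x → p ∤ ↧ₙ y → p ∤ ↧ₙ (x * y)
  ∤↧-* x y = ∤↧-from-↧-product x y (x * y) _ (ℚₚ.↧-* x y)

  ∤↧-+ : ∀ x y → p ∤ ↧ₙ x → p ∤ ↧ₙ y → p ∤ ↧ₙ (x + y)
  ∤↧-+ x y = ∤↧-from-↧-product x y (x + y) _ (ℚₚ.↧-+ x y)

  ∤↧-neg : ∀ x → p ∤ ↧ₙ x → p ∤ ↧ₙ (- x)
  ∤↧-neg x = subst (p ∤_) (cong ℤ.∣_∣ (sym (ℚₚ.↧-neg x)))

  ∤↧-- : ∀ x y → p ∤ ↧ₙ x → p ∤ ↧ₙ y → p ∤ ↧ₙ (x - y)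
  ∤↧-- x y p∤↧x p∤↧y = ∤↧-+ x (- y) p∤↧x (∤↧-neg y p∤↧y)

  ∤↧-ℕ→ℚ : ∀ n → p ∤ ↧ₙ (ℕ→ℚ n)
  ∤↧-ℕ→ℚ n rewrite ℕ→ℚ-mkℚ n = λ p∣1 → ¬prime[1] (subst Prime (∣1⇒≡1 p∣1) p-prime)

  ∤↧-^ : ∀ x k → p ∤ ↧ₙ x → p ∤ ↧ₙ (x ^ℚ k)
  ∤↧-^ x zero p∤↧x = ∤↧-ℕ→ℚ 1
  ∤↧-^ x (suc k) p∤↧x = ∤↧-* x (x ^ℚ k) p∤↧x (∤↧-^ x k p∤↧x)

  ∤↧-1/ : ∀ x .{{_ : NonZero x}} → p ∤ ℤ.∣ ↥ x ∣ → p ∤ ↧ₙ (1/ x)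
  ∤↧-1/ (mkℚ ℤ.+[1+ n ] d c) p∤↥x = p∤↥x
  ∤↧-1/ (mkℚ ℤ.-[1+ n ] d c) p∤↥x = p∤↥x

  p∣↥⇒≡0[mod-p] : ∀ m → p ∤ ↧ₙ m → p ∣ ℤ.∣ ↥ m ∣ → CongMod p 1 m 0ℚ
  p∣↥⇒≡0[mod-p] m p∤↧m p∣↥m with ℤ∣.∣ᵤ⇒∣ {ℤ.+ p} {↥ m} p∣↥m
  ... | ℤ∣.divides j ↥m≡jp = c , ∤↧⇒InZp c p∤↧c , (begin
      m - 0ℚ            ≡⟨ ℚₚ.+-identityʳ m ⟩
      m                 ≡⟨ ℚₚ.toℚᵘ-injective (ℚᵘₚ.≃-sym pc≃m) ⟩
      ℕ→ℚ p * c         ≡⟨ cong (_* c) (ℚₚ.*-identityʳ (ℕ→ℚ p)) ⟨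
      ℕ→ℚ p ^ℚ 1 * c    ∎)
    where
    d = ℚ.denominator-1 m
    c = ℚ.fromℚᵘ (ℚᵘ.mkℚᵘ j d)
    p∤↧c : p ∤ ↧ₙ c
    p∤↧c p∣↧c = p∤↧m (∣-trans p∣↧c ↧c∣↧m)
      where
      ↧c∣↧m : ↧ₙ c ∣ ↧ₙ m
      ↧c∣↧m = divides ℤ.∣ gcd j (ℤ.+ suc d) ∣ (begin
        suc d                                       ≡⟨ cong ℤ.∣_∣ (ℚₚ.↧-/ j (suc d)) ⟨
        ℤ.∣ ↧ c ℤ.* gcd j (ℤ.+ suc d) ∣           ≡⟨ ℤₚ.abs-* (↧ c) (gcd j (ℤ.+ suc d)) ⟩
        ↧ₙ c ℕ.* ℤ.∣ gcd j (ℤ.+ suc d) ∣           ≡⟨ ℕₚ.*-comm (↧ₙ c) _ ⟩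
        ℤ.∣ gcd j (ℤ.+ suc d) ∣ ℕ.* ↧ₙ c           ∎)
    pc≃m : ℚ.toℚᵘ (ℕ→ℚ p * c) ℚᵘ.≃ ℚ.toℚᵘ m
    pc≃m = ℚᵘₚ.≃-trans (ℚₚ.toℚᵘ-homo-* (ℕ→ℚ p) c)
      (ℚᵘₚ.≃-trans (ℚᵘₚ.*-cong (ℚᵘₚ.≃-reflexive (cong ℚ.toℚᵘ (ℕ→ℚ-mkℚ p))) (ℚₚ.toℚᵘ-fromℚᵘ (ℚᵘ.mkℚᵘ j d)))
        (ℚᵘₚ.≃-trans (ℚᵘ.*≡* (cong₂ (λ x y → x ℤ.* ℤ.+ suc y) (trans (ℤₚ.*-comm (ℤ.+ p) j) (sym ↥m≡jp)) (sym (ℕₚ.+-identityʳ d))))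
          (ℚᵘₚ.≃-reflexive (sym (toℚᵘ-unfold m)))))
      where
      toℚᵘ-unfold : ∀ q → ℚ.toℚᵘ q ≡ ℚᵘ.mkℚᵘ (↥ q) (ℚ.denominator-1 q)
      toℚᵘ-unfold (mkℚ _ _ _) = refl

  CongMod-*ˡ : ∀ {e a b} c → p ∤ ↧ₙ c → CongMod p e a b → CongMod p e (c * a) (c * b)
  CongMod-*ˡ {e} {a} {b} c p∤↧c (d , d∈Zp , a-b≡pᵉd) =
    c * d , ∤↧⇒InZp (c * d) (∤↧-* c d p∤↧c (InZp⇒∤↧ d d∈Zp)) , (begin
      c * a - c * b           ≡⟨ factor c a b ⟩
      c * (a - b)             ≡⟨ cong (c *_) a-b≡pᵉd ⟩
      c * (ℕ→ℚ p ^ℚ e * d)    ≡⟨ swap c (ℕ→ℚ p ^ℚ e) d ⟩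
      ℕ→ℚ p ^ℚ e * (c * d)    ∎)
    where
    factor : ∀ c a b → c * a - c * b ≡ c * (a - b)
    factor = solve-∀ ℚ-ring
    swap : ∀ c q d → c * (q * d) ≡ q * (c * d)
    swap = solve-∀ ℚ-ring

  CongMod-sym : ∀ {e a b} → CongMod p e a b → CongMod p e b a
  CongMod-sym {e} {a} {b} (d , d∈Zp , a-b≡pᵉd) =
    - d , ∤↧⇒InZp (- d) (∤↧-neg d (InZp⇒∤↧ d d∈Zp)) , (begin
      b - a                   ≡⟨ flip a b ⟩
      - (a - b)               ≡⟨ cong -_ a-b≡pᵉd ⟩
      - (ℕ→ℚ p ^ℚ e * d)      ≡⟨ ℚₚ.neg-distribʳ-* (ℕ→ℚ p ^ℚ e) d ⟩
      ℕ→ℚ p ^ℚ e * - d        ∎)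
    where
    flip : ∀ a b → b - a ≡ - (a - b)
    flip = solve-∀ ℚ-ring

  CongMod-+ : ∀ {e a b a′ b′} → CongMod p e a b → CongMod p e a′ b′ → CongMod p e (a + a′) (b + b′)
  CongMod-+ {e} {a} {b} {a′} {b′} (d , d∈Zp , a-b≡pᵉd) (d′ , d′∈Zp , a′-b′≡pᵉd′) =
    d + d′ , ∤↧⇒InZp (d + d′) (∤↧-+ d d′ (InZp⇒∤↧ d d∈Zp) (InZp⇒∤↧ d′ d′∈Zp)) , (begin
      a + a′ - (b + b′)                       ≡⟨ regroup a a′ b b′ ⟩
      (a - b) + (a′ - b′)                     ≡⟨ cong₂ _+_ a-b≡pᵉd a′-b′≡pᵉd′ ⟩
      ℕ→ℚ p ^ℚ e * d + ℕ→ℚ p ^ℚ e * d′        ≡⟨ ℚₚ.*-distribˡ-+ (ℕ→ℚ p ^ℚ e) d d′ ⟨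
      ℕ→ℚ p ^ℚ e * (d + d′)                   ∎)
    where
    regroup : ∀ a a′ b b′ → a + a′ - (b + b′) ≡ (a - b) + (a′ - b′)
    regroup = solve-∀ ℚ-ring

  CongMod-sumTo : ∀ {e} n f g → (∀ k → k ℕ.≤ n → CongMod p e (f k) (g k)) → CongMod p e (sumTo n f) (sumTo n g)
  CongMod-sumTo zero f g f≡g = f≡g 0 z≤n
  CongMod-sumTo {e} (suc n) f g f≡g =
    CongMod-+ {e} {sumTo n f} {sumTo n g} {f (suc n)} {g (suc n)} (CongMod-sumTo {e} n f g (λ k k≤n → f≡g k (ℕₚ.m≤n⇒m≤1+n k≤n))) (f≡g (suc n) ℕₚ.≤-refl)

  CongMod-cancelʳ : ∀ {e a b} w → p ∤ ℤ.∣ ↥ w ∣ → .{{_ : ℚ.NonZero w}} → CongMod p e (a * w) (b * w) → CongMod p e a b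
  CongMod-cancelʳ {e} {a} {b} w p∤↥w aw≡bw =
    subst₂ (CongMod p e) (undo a) (undo b) (CongMod-*ˡ {e} (1/ w) (∤↧-1/ w p∤↥w) aw≡bw)
    where
    undo : ∀ x → 1/ w * (x * w) ≡ x
    undo x = begin
      1/ w * (x * w)   ≡⟨ swap (1/ w) x w ⟩
      x * (w * 1/ w)   ≡⟨ cong (x *_) (ℚₚ.*-inverseʳ w) ⟩
      x * 1ℚ           ≡⟨ ℚₚ.*-identityʳ x ⟩
      x                ∎
      where
      swap : ∀ y x w → y * (x * w) ≡ x * (w * y)
      swap = solve-∀ ℚ-ring

ℕ→ℚ-numerator : ∀ n → ℤ.∣ ↥ (ℕ→ℚ n) ∣ ≡ n
ℕ→ℚ-numerator n = cong (λ q → ℤ.∣ ↥ q ∣) (ℕ→ℚ-mkℚ n)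

module _ (n : ℕ) (p-prime : Prime (suc (2 ℕ.* n))) where
  private
    p = suc (2 ℕ.* n)
    N = ℕ→ℚ n

    ∤-between : ∀ a → 0 ℕ.< a → a ℕ.< p → p ∤ a
    ∤-between (suc a) _ a<p p∣a = ℕₚ.<⇒≱ a<p (∣⇒≤ p∣a)

  -- Induction on k; the step divides by (2k+1)(2k+2), a unit mod p as long as k < n.
  [-16]ᵏC[n+k,2k]≡C[2k,k] : ∀ k → k ℕ.≤ n →
    CongMod p 2 ((- ℕ→ℚ 16) ^ℚ k * ℕ→ℚ ((n ℕ.+ k) C (2 ℕ.* k))) (ℕ→ℚ ((2 ℕ.* k) C k))
  [-16]ᵏC[n+k,2k]≡C[2k,k] zero _ =
    0ℚ , ∤↧⇒InZp p-prime 0ℚ (∤↧-ℕ→ℚ p-prime 0) , sym (ℚₚ.*-zeroʳ (ℕ→ℚ p ^ℚ 2))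
  [-16]ᵏC[n+k,2k]≡C[2k,k] (suc k) k<n = CongMod-cancelʳ p-prime {2} {B′} {E′} W p∤W {{W≢0}} (c′ , c′∈Zp , step)
    where
    P = ℕ→ℚ p
    K = ℕ→ℚ k
    B B′ E E′ : ℚ
    B = (- ℕ→ℚ 16) ^ℚ k * ℕ→ℚ ((n ℕ.+ k) C (2 ℕ.* k))
    B′ = (- ℕ→ℚ 16) ^ℚ suc k * ℕ→ℚ ((n ℕ.+ suc k) C (2 ℕ.* suc k))
    E = ℕ→ℚ ((2 ℕ.* k) C k)
    E′ = ℕ→ℚ ((2 ℕ.* suc k) C suc k)
    w = suc (2 ℕ.* k) ℕ.* (2 ℕ.* suc k)
    W = ℕ→ℚ w
    ih = [-16]ᵏC[n+k,2k]≡C[2k,k] k (ℕₚ.<⇒≤ k<n)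
    c = proj₁ ih
    c′ = ℕ→ℚ 4 * (ℕ→ℚ 2 * K + 1ℚ) * (ℕ→ℚ 2 * K + 1ℚ) * c - ℕ→ℚ 4 * B

    p∤W : p ∤ ℤ.∣ ↥ W ∣
    p∤W = subst (p ∤_) (sym (ℕ→ℚ-numerator w))
      (∤-* p-prime (∤-between _ (s≤s z≤n) (s≤s (ℕₚ.*-monoʳ-< 2 k<n)))
                   (∤-between _ (ℕₚ.*-monoʳ-< 2 (s≤s z≤n)) (s≤s (ℕₚ.*-monoʳ-≤ 2 k<n))))
    W≢0 : ℚ.NonZero W
    W≢0 = ℚ.≢-nonZero (ℕ→ℚ-≢0 w {{ℕₚ.m*n≢0 (suc (2 ℕ.* k)) (2 ℕ.* suc k) {{_}} {{ℕₚ.m*n≢0 2 (suc k)}}}})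

    hB : B′ * W ≡ - ℕ→ℚ 16 * ((1ℚ + (N + K)) * (N - K)) * B
    hB = trans (cong (B′ *_) (ℕ→ℚ-* (suc (2 ℕ.* k)) (2 ℕ.* suc k))) ([-16]ᵏC[n+k,2k]-step n k)

    hE : E′ * W ≡ ℕ→ℚ 4 * (ℕ→ℚ 2 * K + 1ℚ) * (ℕ→ℚ 2 * K + 1ℚ) * E
    hE = trans (cong (E′ *_) (ℕ→ℚ-* (suc (2 ℕ.* k)) (2 ℕ.* suc k))) (C[2k,k]-step k)

    step : B′ * W - E′ * W ≡ P ^ℚ 2 * c′
    step = subst (λ q → B′ * W - E′ * W ≡ q ^ℚ 2 * c′) (sym P≡)
      (p²-divides-step N K B E B′ E′ W c hB hE (subst (λ q → B - E ≡ q ^ℚ 2 * c) P≡ (proj₂ (proj₂ ih))))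
      where
      P≡ : P ≡ 1ℚ + ℕ→ℚ 2 * N
      P≡ = trans (ℕ→ℚ-suc (2 ℕ.* n)) (cong (1ℚ +_) (ℕ→ℚ-* 2 n))

    c′∈Zp : InZp p c′
    c′∈Zp = ∤↧⇒InZp p-prime c′
      (∤↧-- p-prime (A * c) (ℕ→ℚ 4 * B) (∤↧-* p-prime A c A∈Zp (InZp⇒∤↧ p-prime c (proj₁ (proj₂ ih))))
        (∤↧-* p-prime (ℕ→ℚ 4) B (∤↧-ℕ→ℚ p-prime 4) B∈Zp))
      where
      A = ℕ→ℚ 4 * (ℕ→ℚ 2 * K + 1ℚ) * (ℕ→ℚ 2 * K + 1ℚ)
      2K+1∈Zp : p ∤ ↧ₙ (ℕ→ℚ 2 * K + 1ℚ)
      2K+1∈Zp = ∤↧-+ p-prime (ℕ→ℚ 2 * K) 1ℚ (∤↧-* p-prime (ℕ→ℚ 2) K (∤↧-ℕ→ℚ p-prime 2) (∤↧-ℕ→ℚ p-prime k)) (∤↧-ℕ→ℚ p-prime 1)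
      A∈Zp : p ∤ ↧ₙ A
      A∈Zp = ∤↧-* p-prime (ℕ→ℚ 4 * (ℕ→ℚ 2 * K + 1ℚ)) (ℕ→ℚ 2 * K + 1ℚ)
               (∤↧-* p-prime (ℕ→ℚ 4) (ℕ→ℚ 2 * K + 1ℚ) (∤↧-ℕ→ℚ p-prime 4) 2K+1∈Zp) 2K+1∈Zp
      B∈Zp : p ∤ ↧ₙ B
      B∈Zp = ∤↧-* p-prime ((- ℕ→ℚ 16) ^ℚ k) (ℕ→ℚ ((n ℕ.+ k) C (2 ℕ.* k)))
               (∤↧-^ p-prime (- ℕ→ℚ 16) k (∤↧-neg p-prime (ℕ→ℚ 16) (∤↧-ℕ→ℚ p-prime 16))) (∤↧-ℕ→ℚ p-prime ((n ℕ.+ k) C (2 ℕ.* k)))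

delay : (ℕ → ℚ) → ℕ → ℚ
delay f zero    = 0ℚ
delay f (suc k) = f k

-- The coefficient of x^(n−2k) in 2ⁿ Pₙ(x).
legendreCoeff : ℕ → ℕ → ℚ
legendreCoeff n k = (- 1ℚ) ^ℚ k * ℕ→ℚ (n C k) * ℕ→ℚ ((2 ℕ.* n ∸ 2 ℕ.* k) C n)

private
  ℕ→ℚ-∸ : ∀ {m n} → n ℕ.≤ m → ℕ→ℚ (m ∸ n) ≡ ℕ→ℚ m - ℕ→ℚ n
  ℕ→ℚ-∸ {m} {n} n≤m = begin
    ℕ→ℚ (m ∸ n)                       ≡⟨ cancel (ℕ→ℚ (m ∸ n)) (ℕ→ℚ n) ⟩
    ℕ→ℚ (m ∸ n) + ℕ→ℚ n - ℕ→ℚ n       ≡⟨ cong (_- ℕ→ℚ n) (ℕ→ℚ-+ (m ∸ n) n) ⟨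
    ℕ→ℚ (m ∸ n ℕ.+ n) - ℕ→ℚ n         ≡⟨ cong (λ x → ℕ→ℚ x - ℕ→ℚ n) (ℕₚ.m∸n+n≡m n≤m) ⟩
    ℕ→ℚ m - ℕ→ℚ n                     ∎
    where
    cancel : ∀ x y → x ≡ x + y - y
    cancel = solve-∀ ℚ-ring

  legendreCoeff-rec-identity : ∀ N N₁ N₂ J J₁ Z Z₁ Z₂ σ X B →
    N₁ ≡ 1ℚ + N → N₂ ≡ 1ℚ + N₁ → J₁ ≡ 1ℚ + J → Z₁ ≡ 1ℚ + Z → Z₂ ≡ 1ℚ + Z₁ → Z ≡ ℕ→ℚ 2 * N - ℕ→ℚ 2 * J →
    N₂ * (- 1ℚ * σ) * (N₂ * X) * (Z₂ * (Z₁ * B))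
      ≡ ℕ→ℚ 2 * (ℕ→ℚ 2 * N₁ + 1ℚ) * (- 1ℚ * σ * (X * (N₁ - J)) * (B * (Z - N))) * N₂ - ℕ→ℚ 4 * N₁ * (σ * (X * (N₁ - J)) * B) * J₁ * N₂
  legendreCoeff-rec-identity N _ _ J _ _ _ _ σ X B refl refl refl refl refl refl = identity N J σ X B
    where
    identity : ∀ N J σ X B →
      (1ℚ + (1ℚ + N)) * (- 1ℚ * σ) * ((1ℚ + (1ℚ + N)) * X) * ((1ℚ + (1ℚ + (ℕ→ℚ 2 * N - ℕ→ℚ 2 * J))) * ((1ℚ + (ℕ→ℚ 2 * N - ℕ→ℚ 2 * J)) * B))
        ≡ ℕ→ℚ 2 * (ℕ→ℚ 2 * (1ℚ + N) + 1ℚ) * (- 1ℚ * σ * (X * (1ℚ + N - J)) * (B * (ℕ→ℚ 2 * N - ℕ→ℚ 2 * J - N))) * (1ℚ + (1ℚ + N))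
          - ℕ→ℚ 4 * (1ℚ + N) * (σ * (X * (1ℚ + N - J)) * B) * (1ℚ + J) * (1ℚ + (1ℚ + N))
    identity = solve-∀ ℚ-ring

module _ (n j : ℕ) (j≤n : j ℕ.≤ n) where
  private
    z = 2 ℕ.* n ∸ 2 ℕ.* j
    N = ℕ→ℚ n
    N₁ = ℕ→ℚ (suc n)
    N₂ = ℕ→ℚ (suc (suc n))
    J = ℕ→ℚ j
    J₁ = ℕ→ℚ (suc j)
    Z = ℕ→ℚ z
    Z₁ = ℕ→ℚ (suc z)
    Z₂ = ℕ→ℚ (suc (suc z))
    σ = (- 1ℚ) ^ℚ j
    σ′ = (- 1ℚ) ^ℚ suc j
    X = ℕ→ℚ (suc n C j)
    A₂ = ℕ→ℚ (suc (suc n) C suc j)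
    B₂ = ℕ→ℚ ((2 ℕ.* suc (suc n) ∸ 2 ℕ.* suc j) C suc (suc n))
    A₁ = ℕ→ℚ (suc n C suc j)
    B₁ = ℕ→ℚ ((2 ℕ.* suc n ∸ 2 ℕ.* suc j) C suc n)
    Aₘ = ℕ→ℚ (n C j)
    Bₘ = ℕ→ℚ (z C n)
    c₂ = ℕ→ℚ 2 * (ℕ→ℚ 2 * N₁ + 1ℚ)
    c₄ = ℕ→ℚ 4 * N₁
    D = J₁ * N₁ * N₂

    D≢0 : D ≢ 0ℚ
    D≢0 = *-≢0 (*-≢0 (ℕ→ℚ-≢0 (suc j)) (ℕ→ℚ-≢0 (suc n))) (ℕ→ℚ-≢0 (suc (suc n)))

    2j≤2n : 2 ℕ.* j ℕ.≤ 2 ℕ.* n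
    2j≤2n = ℕₚ.*-monoʳ-≤ 2 j≤n
    2[n+1]-2[j+1]≡z : 2 ℕ.* suc n ∸ 2 ℕ.* suc j ≡ z
    2[n+1]-2[j+1]≡z = cong₂ _∸_ (ℕₚ.*-suc 2 n) (ℕₚ.*-suc 2 j)
    2[n+2]-2[j+1]≡z+2 : 2 ℕ.* suc (suc n) ∸ 2 ℕ.* suc j ≡ suc (suc z)
    2[n+2]-2[j+1]≡z+2 = begin
      2 ℕ.* suc (suc n) ∸ 2 ℕ.* suc j   ≡⟨ cong₂ _∸_ (ℕₚ.*-suc 2 (suc n)) (ℕₚ.*-suc 2 j) ⟩
      2 ℕ.* suc n ∸ 2 ℕ.* j             ≡⟨ cong (_∸ 2 ℕ.* j) (ℕₚ.*-suc 2 n) ⟩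
      2 ℕ.+ 2 ℕ.* n ∸ 2 ℕ.* j           ≡⟨ ℕₚ.+-∸-assoc 2 2j≤2n ⟩
      suc (suc z)                       ∎
    Z≡ : Z ≡ ℕ→ℚ 2 * N - ℕ→ℚ 2 * J
    Z≡ = trans (ℕ→ℚ-∸ 2j≤2n) (cong₂ _-_ (ℕ→ℚ-* 2 n) (ℕ→ℚ-* 2 j))

    regroupˡ : ∀ n₂ s a b j₁ n₁ → n₂ * (s * a * b) * (j₁ * n₁ * n₂) ≡ n₂ * s * (a * j₁) * (b * n₂) * n₁
    regroupˡ = solve-∀ ℚ-ring
    regroupˡ′ : ∀ a z c n₁ → a * (z * c) * n₁ ≡ a * (z * (c * n₁))
    regroupˡ′ = solve-∀ ℚ-ring
    regroupʳ : ∀ c₂ c₄ s′ s a₁ b₁ aₘ bₘ j₁ n₁ n₂ →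
      c₂ * (s′ * (a₁ * j₁) * (b₁ * n₁)) * n₂ - c₄ * (s * (n₁ * aₘ) * bₘ) * j₁ * n₂
        ≡ (c₂ * (s′ * a₁ * b₁) - c₄ * (s * aₘ * bₘ)) * (j₁ * n₁ * n₂)
    regroupʳ = solve-∀ ℚ-ring

  -- Multiplied by (j+1)(n+1)(n+2), absorption expresses all six binomials through C(n+1,j) and C(2n−2j,n).
  legendreCoeff-rec-suc :
    ℕ→ℚ (suc (suc n)) * legendreCoeff (suc (suc n)) (suc j)
      ≡ ℕ→ℚ 2 * (ℕ→ℚ 2 * ℕ→ℚ (suc n) + 1ℚ) * legendreCoeff (suc n) (suc j) - ℕ→ℚ 4 * ℕ→ℚ (suc n) * delay (legendreCoeff n) (suc j)
  legendreCoeff-rec-suc = *-cancelʳ-≢0 D D≢0 (begin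
      N₂ * (σ′ * A₂ * B₂) * D
        ≡⟨ regroupˡ N₂ σ′ A₂ B₂ J₁ N₁ ⟩
      N₂ * σ′ * (A₂ * J₁) * (B₂ * N₂) * N₁
        ≡⟨ cong₂ (λ a b → N₂ * σ′ * a * b * N₁) ([n+1]C[k+1]*[k+1]≡[n+1]*nCk (suc n) j) (cong (λ x → ℕ→ℚ (x C suc (suc n)) * N₂) 2[n+2]-2[j+1]≡z+2) ⟩
      N₂ * σ′ * (N₂ * X) * (ℕ→ℚ (suc (suc z) C suc (suc n)) * N₂) * N₁
        ≡⟨ cong (λ b → N₂ * σ′ * (N₂ * X) * b * N₁) ([n+1]C[k+1]*[k+1]≡[n+1]*nCk (suc z) (suc n)) ⟩
      N₂ * σ′ * (N₂ * X) * (Z₂ * ℕ→ℚ (suc z C suc n)) * N₁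
        ≡⟨ regroupˡ′ (N₂ * σ′ * (N₂ * X)) Z₂ (ℕ→ℚ (suc z C suc n)) N₁ ⟩
      N₂ * σ′ * (N₂ * X) * (Z₂ * (ℕ→ℚ (suc z C suc n) * N₁))
        ≡⟨ cong (λ b → N₂ * σ′ * (N₂ * X) * (Z₂ * b)) ([n+1]C[k+1]*[k+1]≡[n+1]*nCk z n) ⟩
      N₂ * σ′ * (N₂ * X) * (Z₂ * (Z₁ * Bₘ))
        ≡⟨ legendreCoeff-rec-identity N N₁ N₂ J J₁ Z Z₁ Z₂ σ X Bₘ (ℕ→ℚ-suc n) (ℕ→ℚ-suc (suc n)) (ℕ→ℚ-suc j) (ℕ→ℚ-suc z) (ℕ→ℚ-suc (suc z)) Z≡ ⟩
      c₂ * (σ′ * (X * (N₁ - J)) * (Bₘ * (Z - N))) * N₂ - c₄ * (σ * (X * (N₁ - J)) * Bₘ) * J₁ * N₂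
        ≡⟨ cong₂ (λ a b → c₂ * (σ′ * a * b) * N₂ - c₄ * (σ * (X * (N₁ - J)) * Bₘ) * J₁ * N₂) (nC[k+1]*[k+1]≡nCk*[n-k] (suc n) j) (nC[k+1]*[k+1]≡nCk*[n-k] z n) ⟨
      c₂ * (σ′ * (A₁ * J₁) * (ℕ→ℚ (z C suc n) * N₁)) * N₂ - c₄ * (σ * (X * (N₁ - J)) * Bₘ) * J₁ * N₂
        ≡⟨ cong (λ a → c₂ * (σ′ * (A₁ * J₁) * (ℕ→ℚ (z C suc n) * N₁)) * N₂ - c₄ * (σ * a * Bₘ) * J₁ * N₂) (trans (sym (nC[k+1]*[k+1]≡nCk*[n-k] (suc n) j)) ([n+1]C[k+1]*[k+1]≡[n+1]*nCk n j)) ⟩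
      c₂ * (σ′ * (A₁ * J₁) * (ℕ→ℚ (z C suc n) * N₁)) * N₂ - c₄ * (σ * (N₁ * Aₘ) * Bₘ) * J₁ * N₂
        ≡⟨ regroupʳ c₂ c₄ σ′ σ A₁ (ℕ→ℚ (z C suc n)) Aₘ Bₘ J₁ N₁ N₂ ⟩
      (c₂ * (σ′ * A₁ * ℕ→ℚ (z C suc n)) - c₄ * (σ * Aₘ * Bₘ)) * D
        ≡⟨ cong (λ x → (c₂ * (σ′ * A₁ * ℕ→ℚ (x C suc n)) - c₄ * (σ * Aₘ * Bₘ)) * D) 2[n+1]-2[j+1]≡z ⟨
      (c₂ * (σ′ * A₁ * B₁) - c₄ * (σ * Aₘ * Bₘ)) * D ∎)

-- Bonnet's recurrence (n+1) Pₙ₊₁ = (2n+1) x Pₙ − n Pₙ₋₁, read off on the coefficients of 2ⁿ Pₙ (at n+1).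
legendreCoeff-rec : ∀ n k → k ℕ.≤ suc n →
  ℕ→ℚ (suc (suc n)) * legendreCoeff (suc (suc n)) k
    ≡ ℕ→ℚ 2 * (ℕ→ℚ 2 * ℕ→ℚ (suc n) + 1ℚ) * legendreCoeff (suc n) k - ℕ→ℚ 4 * ℕ→ℚ (suc n) * delay (legendreCoeff n) k
legendreCoeff-rec n zero _ = begin
    N₂ * (1ℚ * 1ℚ * E₂)                  ≡⟨ reorder N₂ E₂ ⟩
    E₂ * N₂                              ≡⟨ [2k+2]C[k+1]*[k+1]≡2[2k+1]*[2k]Ck (suc n) ⟩
    ℕ→ℚ 2 * ℕ→ℚ (suc (2 ℕ.* suc n)) * E₁ ≡⟨ cong (λ x → ℕ→ℚ 2 * x * E₁) (trans (ℕ→ℚ-suc (2 ℕ.* suc n)) (cong (1ℚ +_) (ℕ→ℚ-* 2 (suc n)))) ⟩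
    ℕ→ℚ 2 * (1ℚ + ℕ→ℚ 2 * N₁) * E₁       ≡⟨ finish N₁ E₁ ⟩
    ℕ→ℚ 2 * (ℕ→ℚ 2 * N₁ + 1ℚ) * (1ℚ * 1ℚ * E₁) - ℕ→ℚ 4 * N₁ * 0ℚ ∎
  where
  N₁ = ℕ→ℚ (suc n)
  N₂ = ℕ→ℚ (suc (suc n))
  E₁ = ℕ→ℚ ((2 ℕ.* suc n) C suc n)
  E₂ = ℕ→ℚ ((2 ℕ.* suc (suc n)) C suc (suc n))
  reorder : ∀ a e → a * (1ℚ * 1ℚ * e) ≡ e * a
  reorder = solve-∀ ℚ-ring
  finish : ∀ n e → ℕ→ℚ 2 * (1ℚ + ℕ→ℚ 2 * n) * e ≡ ℕ→ℚ 2 * (ℕ→ℚ 2 * n + 1ℚ) * (1ℚ * 1ℚ * e) - ℕ→ℚ 4 * n * 0ℚ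
  finish = solve-∀ ℚ-ring
legendreCoeff-rec n (suc j) (s≤s j≤n) = legendreCoeff-rec-suc n j j≤n

legendreCoeff-top≡0 : ∀ m → legendreCoeff (suc (2 ℕ.* m)) (suc m) ≡ 0ℚ
legendreCoeff-top≡0 m = begin
  σ * A * ℕ→ℚ ((2 ℕ.* suc (2 ℕ.* m) ∸ 2 ℕ.* suc m) C suc (2 ℕ.* m)) ≡⟨ cong (λ x → σ * A * ℕ→ℚ (x C suc (2 ℕ.* m))) 2[1+2m]-2[1+m]≡2m ⟩
  σ * A * ℕ→ℚ ((2 ℕ.* m) C suc (2 ℕ.* m))                          ≡⟨ cong (λ x → σ * A * ℕ→ℚ x) (k>n⇒nCk≡0 {2 ℕ.* m} {suc (2 ℕ.* m)} ℕₚ.≤-refl) ⟩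
  σ * A * 0ℚ                                                      ≡⟨ ℚₚ.*-zeroʳ (σ * A) ⟩
  0ℚ                                                              ∎
  where
  σ = (- 1ℚ) ^ℚ suc m
  A = ℕ→ℚ (suc (2 ℕ.* m) C suc m)
  2[1+2m]-2[1+m]≡2m : 2 ℕ.* suc (2 ℕ.* m) ∸ 2 ℕ.* suc m ≡ 2 ℕ.* m
  2[1+2m]-2[1+m]≡2m = begin
    2 ℕ.* suc (2 ℕ.* m) ∸ 2 ℕ.* suc m   ≡⟨ cong₂ _∸_ (ℕₚ.*-suc 2 (2 ℕ.* m)) (ℕₚ.*-suc 2 m) ⟩
    2 ℕ.* (2 ℕ.* m) ∸ 2 ℕ.* m           ≡⟨ ℕₚ.m+n∸m≡n (2 ℕ.* m) (2 ℕ.* m ℕ.+ 0) ⟩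
    2 ℕ.* m ℕ.+ 0                       ≡⟨ ℕₚ.+-identityʳ (2 ℕ.* m) ⟩
    2 ℕ.* m                             ∎

module _ (u : ℚ) where

  descending : (ℕ → ℚ) → ℕ → ℚ
  descending c M = sumTo M (λ k → c k * u ^ℚ (M ∸ k))

  descending-delay : ∀ c M → descending (delay c) (suc M) ≡ descending c M
  descending-delay c M = begin
    sumTo (suc M) (λ k → delay c k * u ^ℚ (suc M ∸ k))  ≡⟨ sumTo-suc M (λ k → delay c k * u ^ℚ (suc M ∸ k)) ⟩
    0ℚ * u ^ℚ suc M + descending c M                    ≡⟨ cong (_+ descending c M) (ℚₚ.*-zeroˡ (u ^ℚ suc M)) ⟩
    0ℚ + descending c M                                 ≡⟨ ℚₚ.+-identityˡ (descending c M) ⟩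
    descending c M                                      ∎

  descending-top : ∀ c M → c (suc M) ≡ 0ℚ → descending c (suc M) ≡ u * descending c M
  descending-top c M c[1+M]≡0 = begin
    S′ + c (suc M) * u ^ℚ (M′ ∸ M′)                  ≡⟨ cong (λ x → S′ + x * u ^ℚ (M′ ∸ M′)) c[1+M]≡0 ⟩
    S′ + 0ℚ * u ^ℚ (M′ ∸ M′)                         ≡⟨ cong (S′ +_) (ℚₚ.*-zeroˡ (u ^ℚ (M′ ∸ M′))) ⟩
    S′ + 0ℚ                                          ≡⟨ ℚₚ.+-identityʳ S′ ⟩
    sumTo M (λ k → c k * u ^ℚ (M′ ∸ k))              ≡⟨ sumTo-cong M (λ k k≤M → cong (λ e → c k * u ^ℚ e) (ℕₚ.+-∸-assoc 1 k≤M)) ⟩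
    sumTo M (λ k → c k * (u * u ^ℚ (M ∸ k)))         ≡⟨ sumTo-cong M (λ k _ → swap (c k) u (u ^ℚ (M ∸ k))) ⟩
    sumTo M (λ k → u * (c k * u ^ℚ (M ∸ k)))         ≡⟨ sumTo-*ˡ M u (λ k → c k * u ^ℚ (M ∸ k)) ⟩
    u * descending c M                               ∎
    where
    M′ = suc M
    S′ = sumTo M (λ k → c k * u ^ℚ (M′ ∸ k))
    swap : ∀ a u w → a * (u * w) ≡ u * (a * w)
    swap = solve-∀ ℚ-ring

  descending-rec : ∀ n M → M ℕ.≤ suc n →
    ℕ→ℚ (suc (suc n)) * descending (legendreCoeff (suc (suc n))) M
      ≡ ℕ→ℚ 2 * (ℕ→ℚ 2 * ℕ→ℚ (suc n) + 1ℚ) * descending (legendreCoeff (suc n)) M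
        - ℕ→ℚ 4 * ℕ→ℚ (suc n) * descending (delay (legendreCoeff n)) M
  descending-rec n M M≤1+n = begin
    a * descending (legendreCoeff (suc (suc n))) M
      ≡⟨ sumTo-*ˡ M a (λ k → legendreCoeff (suc (suc n)) k * w k) ⟨
    sumTo M (λ k → a * (legendreCoeff (suc (suc n)) k * w k))
      ≡⟨ sumTo-cong M termwise ⟩
    sumTo M (λ k → x k + - y k)
      ≡⟨ sumTo-+ M x (λ k → - y k) ⟩
    sumTo M x + sumTo M (λ k → - y k)
      ≡⟨ cong₂ _+_ (sumTo-*ˡ M b (λ k → legendreCoeff (suc n) k * w k)) (trans (sumTo-neg M y) (cong -_ (sumTo-*ˡ M c (λ k → delay (legendreCoeff n) k * w k)))) ⟩
    b * descending (legendreCoeff (suc n)) M - c * descending (delay (legendreCoeff n)) M ∎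
    where
    a = ℕ→ℚ (suc (suc n))
    b = ℕ→ℚ 2 * (ℕ→ℚ 2 * ℕ→ℚ (suc n) + 1ℚ)
    c = ℕ→ℚ 4 * ℕ→ℚ (suc n)
    w : ℕ → ℚ
    w k = u ^ℚ (M ∸ k)
    x y : ℕ → ℚ
    x k = b * (legendreCoeff (suc n) k * w k)
    y k = c * (delay (legendreCoeff n) k * w k)
    distrib : ∀ a q b x c y w → a * q ≡ b * x - c * y → a * (q * w) ≡ b * (x * w) + - (c * (y * w))
    distrib a q b x c y w eq = begin
      a * (q * w)                   ≡⟨ ℚₚ.*-assoc a q w ⟨
      a * q * w                     ≡⟨ cong (_* w) eq ⟩
      (b * x - c * y) * w           ≡⟨ expand b x c y w ⟩
      b * (x * w) + - (c * (y * w)) ∎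
      where
      expand : ∀ b x c y w → (b * x - c * y) * w ≡ b * (x * w) + - (c * (y * w))
      expand = solve-∀ ℚ-ring
    termwise : ∀ k → k ℕ.≤ M → a * (legendreCoeff (suc (suc n)) k * w k) ≡ x k + - y k
    termwise k k≤M = distrib a _ b _ c _ (w k) (legendreCoeff-rec n k (ℕₚ.≤-trans k≤M M≤1+n))

  private
    h : ℚ
    h = 1/ ℕ→ℚ 2

  descending-parity : ∀ n →
    descending (legendreCoeff (suc n)) (suc (n / 2)) ≡ u ^ℚ (suc n % 2) * descending (legendreCoeff (suc n)) (suc n / 2)
  descending-parity n = by-parity (evenOdd n)
    where
    by-parity : ∀ {n} → EvenOdd n →
      descending (legendreCoeff (suc n)) (suc (n / 2)) ≡ u ^ℚ (suc n % 2) * descending (legendreCoeff (suc n)) (suc n / 2)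
    by-parity (even m) = begin
      descending c (suc (2 ℕ.* m / 2))         ≡⟨ cong (λ x → descending c (suc x)) (2m/2≡m m) ⟩
      descending c (suc m)                     ≡⟨ descending-top c m (legendreCoeff-top≡0 m) ⟩
      u * descending c m                       ≡⟨ cong (_* descending c m) (ℚₚ.*-identityʳ u) ⟨
      u ^ℚ 1 * descending c m                  ≡⟨ cong₂ (λ e x → u ^ℚ e * descending c x) ([1+2m]%2≡1 m) ([1+2m]/2≡m m) ⟨
      u ^ℚ (suc (2 ℕ.* m) % 2) * descending c (suc (2 ℕ.* m) / 2) ∎
      where
      c = legendreCoeff (suc (2 ℕ.* m))
    by-parity (odd m) = begin
      descending c (suc (suc (2 ℕ.* m) / 2))   ≡⟨ cong (λ x → descending c (suc x)) ([1+2m]/2≡m m) ⟩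
      descending c (suc m)                     ≡⟨ ℚₚ.*-identityˡ (descending c (suc m)) ⟨
      1ℚ * descending c (suc m)                ≡⟨ cong₂ (λ e x → u ^ℚ e * descending c x) (trans ([2+n]%2≡n%2 (2 ℕ.* m)) (2m%2≡0 m)) (trans ([2+n]/2≡1+n/2 (2 ℕ.* m)) (cong suc (2m/2≡m m))) ⟨
      u ^ℚ (suc (suc (2 ℕ.* m)) % 2) * descending c (suc (suc (2 ℕ.* m)) / 2) ∎
      where
      c = legendreCoeff (suc (suc (2 ℕ.* m)))

  -- Bonnet's recurrence for Qₙ, where Pₙ(x) = x^(n % 2) Qₙ(x²): a factor u enters when the middle index is odd.
  legendreQ-rec : ∀ n →
    ℕ→ℚ (suc (suc n)) * legendreQ (suc (suc n)) u
      ≡ (ℕ→ℚ 2 * ℕ→ℚ (suc n) + 1ℚ) * u ^ℚ (suc n % 2) * legendreQ (suc n) u - ℕ→ℚ (suc n) * legendreQ n u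
  legendreQ-rec n = begin
    N₂ * (h ^ℚ suc (suc n) * descending (legendreCoeff (suc (suc n))) (suc (suc n) / 2))
      ≡⟨ cong (λ M → N₂ * (h ^ℚ suc (suc n) * descending (legendreCoeff (suc (suc n))) M)) ([2+n]/2≡1+n/2 n) ⟩
    N₂ * (h ^ℚ suc (suc n) * descending (legendreCoeff (suc (suc n))) (suc (n / 2)))
      ≡⟨ swap N₂ (h ^ℚ suc (suc n)) _ ⟩
    h ^ℚ suc (suc n) * (N₂ * descending (legendreCoeff (suc (suc n))) (suc (n / 2)))
      ≡⟨ cong (h ^ℚ suc (suc n) *_) (descending-rec n (suc (n / 2)) (s≤s (m/n≤m n 2))) ⟩
    h ^ℚ suc (suc n) * (ℕ→ℚ 2 * (ℕ→ℚ 2 * N₁ + 1ℚ) * descending (legendreCoeff (suc n)) (suc (n / 2)) - ℕ→ℚ 4 * N₁ * descending (delay (legendreCoeff n)) (suc (n / 2)))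
      ≡⟨ cong₂ (λ x y → h ^ℚ suc (suc n) * (ℕ→ℚ 2 * (ℕ→ℚ 2 * N₁ + 1ℚ) * x - ℕ→ℚ 4 * N₁ * y)) (descending-parity n) (descending-delay (legendreCoeff n) (n / 2)) ⟩
    h ^ℚ suc (suc n) * (ℕ→ℚ 2 * (ℕ→ℚ 2 * N₁ + 1ℚ) * (w * descending (legendreCoeff (suc n)) (suc n / 2)) - ℕ→ℚ 4 * N₁ * descending (legendreCoeff n) (n / 2))
      ≡⟨ halve (h ^ℚ n) N₁ w _ _ ⟩
    (ℕ→ℚ 2 * N₁ + 1ℚ) * w * (h ^ℚ suc n * descending (legendreCoeff (suc n)) (suc n / 2)) - N₁ * (h ^ℚ n * descending (legendreCoeff n) (n / 2)) ∎
    where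
    N₁ = ℕ→ℚ (suc n)
    N₂ = ℕ→ℚ (suc (suc n))
    w = u ^ℚ (suc n % 2)
    swap : ∀ a b c → a * (b * c) ≡ b * (a * c)
    swap = solve-∀ ℚ-ring
    halve : ∀ H N w S₁ S₀ →
      1/ ℕ→ℚ 2 * (1/ ℕ→ℚ 2 * H) * (ℕ→ℚ 2 * (ℕ→ℚ 2 * N + 1ℚ) * (w * S₁) - ℕ→ℚ 4 * N * S₀)
        ≡ (ℕ→ℚ 2 * N + 1ℚ) * w * (1/ ℕ→ℚ 2 * H * S₁) - N * (H * S₀)
    halve = solve-∀ ℚ-ring

-- The cross term y₁y₂ is eliminated using the first recurrence together with its square.
square-recurrence : ∀ a b d a′ b′ d′ y₀ y₁ y₂ y₃ →
  d′ * y₂ ≡ a′ * y₁ - b′ * y₀ → d * y₃ ≡ a * y₂ - b * y₁ →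
  a′ * d′ * ((d * y₃) * (d * y₃))
    ≡ (a′ * d′ * a * a - a * b * d′ * d′) * (y₂ * y₂) + (a′ * d′ * b * b - a * b * a′ * a′) * (y₁ * y₁) + a * b * b′ * b′ * (y₀ * y₀)
square-recurrence a b d a′ b′ d′ y₀ y₁ y₂ y₃ rec₁ rec₂ = begin
    a′ * d′ * ((d * y₃) * (d * y₃))
      ≡⟨ cong (λ x → a′ * d′ * (x * x)) rec₂ ⟩
    a′ * d′ * ((a * y₂ - b * y₁) * (a * y₂ - b * y₁))
      ≡⟨ expand a b a′ d′ y₁ y₂ ⟩
    a′ * d′ * a * a * (y₂ * y₂) + a′ * d′ * b * b * (y₁ * y₁) - ℕ→ℚ 2 * a * b * a′ * y₁ * (d′ * y₂)
      ≡⟨ cong (λ x → a′ * d′ * a * a * (y₂ * y₂) + a′ * d′ * b * b * (y₁ * y₁) - ℕ→ℚ 2 * a * b * a′ * y₁ * x) rec₁ ⟩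
    a′ * d′ * a * a * (y₂ * y₂) + a′ * d′ * b * b * (y₁ * y₁) - ℕ→ℚ 2 * a * b * a′ * y₁ * (a′ * y₁ - b′ * y₀)
      ≡⟨ complete a b a′ b′ d′ y₀ y₁ y₂ ⟩
    a′ * d′ * a * a * (y₂ * y₂) + (a′ * d′ * b * b - a * b * a′ * a′) * (y₁ * y₁) - a * b * ((a′ * y₁ - b′ * y₀) * (a′ * y₁ - b′ * y₀) - b′ * b′ * (y₀ * y₀))
      ≡⟨ cong (λ x → a′ * d′ * a * a * (y₂ * y₂) + (a′ * d′ * b * b - a * b * a′ * a′) * (y₁ * y₁) - a * b * (x * x - b′ * b′ * (y₀ * y₀))) rec₁ ⟨
    a′ * d′ * a * a * (y₂ * y₂) + (a′ * d′ * b * b - a * b * a′ * a′) * (y₁ * y₁) - a * b * ((d′ * y₂) * (d′ * y₂) - b′ * b′ * (y₀ * y₀))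
      ≡⟨ collect a b a′ b′ d′ y₀ y₁ y₂ ⟩
    (a′ * d′ * a * a - a * b * d′ * d′) * (y₂ * y₂) + (a′ * d′ * b * b - a * b * a′ * a′) * (y₁ * y₁) + a * b * b′ * b′ * (y₀ * y₀) ∎
  where
  expand : ∀ a b a′ d′ y₁ y₂ → a′ * d′ * ((a * y₂ - b * y₁) * (a * y₂ - b * y₁))
    ≡ a′ * d′ * a * a * (y₂ * y₂) + a′ * d′ * b * b * (y₁ * y₁) - ℕ→ℚ 2 * a * b * a′ * y₁ * (d′ * y₂)
  expand = solve-∀ ℚ-ring
  complete : ∀ a b a′ b′ d′ y₀ y₁ y₂ →
    a′ * d′ * a * a * (y₂ * y₂) + a′ * d′ * b * b * (y₁ * y₁) - ℕ→ℚ 2 * a * b * a′ * y₁ * (a′ * y₁ - b′ * y₀)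
      ≡ a′ * d′ * a * a * (y₂ * y₂) + (a′ * d′ * b * b - a * b * a′ * a′) * (y₁ * y₁) - a * b * ((a′ * y₁ - b′ * y₀) * (a′ * y₁ - b′ * y₀) - b′ * b′ * (y₀ * y₀))
  complete = solve-∀ ℚ-ring
  collect : ∀ a b a′ b′ d′ y₀ y₁ y₂ →
    a′ * d′ * a * a * (y₂ * y₂) + (a′ * d′ * b * b - a * b * a′ * a′) * (y₁ * y₁) - a * b * ((d′ * y₂) * (d′ * y₂) - b′ * b′ * (y₀ * y₀))
      ≡ (a′ * d′ * a * a - a * b * d′ * d′) * (y₂ * y₂) + (a′ * d′ * b * b - a * b * a′ * a′) * (y₁ * y₁) + a * b * b′ * b′ * (y₀ * y₀)
  collect = solve-∀ ℚ-ring

-- The third-order recurrence, in s, satisfied both by Pₛ(√u)² and by Σₖ C(s+k,2k) C(2k,k)² ((u−1)/4)ᵏ.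
α δ : ℚ → ℚ
α S = (ℕ→ℚ 2 * S + ℕ→ℚ 3) * ((S + ℕ→ℚ 3) * (S + ℕ→ℚ 3))
δ S = (ℕ→ℚ 2 * S + ℕ→ℚ 5) * ((S + 1ℚ) * (S + 1ℚ))

β γ : ℚ → ℚ → ℚ
β u S = (ℕ→ℚ 2 * S + ℕ→ℚ 5) * ((ℕ→ℚ 2 * S + ℕ→ℚ 3) * (ℕ→ℚ 2 * S + ℕ→ℚ 5) * u - (S + ℕ→ℚ 2) * (S + ℕ→ℚ 2))
γ u S = (ℕ→ℚ 2 * S + ℕ→ℚ 3) * ((S + ℕ→ℚ 2) * (S + ℕ→ℚ 2) - (ℕ→ℚ 2 * S + ℕ→ℚ 3) * (ℕ→ℚ 2 * S + ℕ→ℚ 5) * u)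

Recurrent : ℚ → (ℕ → ℚ) → Set
Recurrent u a = ∀ s → let S = ℕ→ℚ s in
  α S * a (suc (suc (suc s))) ≡ β u S * a (suc (suc s)) + γ u S * a (suc s) + δ S * a s

α≢0 : ∀ s → α (ℕ→ℚ s) ≢ 0ℚ
α≢0 s = *-≢0 (λ eq → ℕ→ℚ-≢0 (suc (suc (suc (2 ℕ.* s)))) (trans (cast₁ s) eq))
              (*-≢0 (λ eq → ℕ→ℚ-≢0 (suc (suc (suc s))) (trans (cast₂ s) eq)) (λ eq → ℕ→ℚ-≢0 (suc (suc (suc s))) (trans (cast₂ s) eq)))
  where
  cast₁ : ∀ s → ℕ→ℚ (3 ℕ.+ 2 ℕ.* s) ≡ ℕ→ℚ 2 * ℕ→ℚ s + ℕ→ℚ 3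
  cast₁ s = trans (ℕ→ℚ-+ 3 (2 ℕ.* s)) (trans (cong (ℕ→ℚ 3 +_) (ℕ→ℚ-* 2 s)) (ℚₚ.+-comm (ℕ→ℚ 3) (ℕ→ℚ 2 * ℕ→ℚ s)))
  cast₂ : ∀ s → ℕ→ℚ (3 ℕ.+ s) ≡ ℕ→ℚ s + ℕ→ℚ 3
  cast₂ s = trans (ℕ→ℚ-+ 3 s) (ℚₚ.+-comm (ℕ→ℚ 3) (ℕ→ℚ s))

recurrent-unique : ∀ {u a b} → Recurrent u a → Recurrent u b →
  a 0 ≡ b 0 → a 1 ≡ b 1 → a 2 ≡ b 2 → ∀ n → a n ≡ b n
recurrent-unique {u} {a} {b} rec-a rec-b a₀ a₁ a₂ n = proj₁ (window n)
  where
  window : ∀ s → a s ≡ b s × a (suc s) ≡ b (suc s) × a (suc (suc s)) ≡ b (suc (suc s))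
  window zero = a₀ , a₁ , a₂
  window (suc s) with window s
  ... | e₀ , e₁ , e₂ = e₁ , e₂ , *-cancelʳ-≢0 (α S) (α≢0 s) (begin
      a (3 ℕ.+ s) * α S                                      ≡⟨ ℚₚ.*-comm (a (3 ℕ.+ s)) (α S) ⟩
      α S * a (3 ℕ.+ s)                                      ≡⟨ rec-a s ⟩
      β u S * a (2 ℕ.+ s) + γ u S * a (suc s) + δ S * a s    ≡⟨ cong₂ (λ x y → β u S * x + γ u S * y + δ S * a s) e₂ e₁ ⟩
      β u S * b (2 ℕ.+ s) + γ u S * b (suc s) + δ S * a s    ≡⟨ cong (λ x → β u S * b (2 ℕ.+ s) + γ u S * b (suc s) + δ S * x) e₀ ⟩
      β u S * b (2 ℕ.+ s) + γ u S * b (suc s) + δ S * b s    ≡⟨ rec-b s ⟨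
      α S * b (3 ℕ.+ s)                                      ≡⟨ ℚₚ.*-comm (α S) (b (3 ℕ.+ s)) ⟩
      b (3 ℕ.+ s) * α S                                      ∎)
    where S = ℕ→ℚ s

private
  legendreSq-rec-lhs : ∀ S N₁ N₂ N₃ w₁ Q₃ → N₁ ≡ 1ℚ + S → N₂ ≡ 1ℚ + N₁ → N₃ ≡ 1ℚ + N₂ →
    α S * (w₁ * (Q₃ * Q₃)) * N₂ ≡ (ℕ→ℚ 2 * N₁ + 1ℚ) * w₁ * N₂ * ((N₃ * Q₃) * (N₃ * Q₃))
  legendreSq-rec-lhs S _ _ _ w₁ Q₃ refl refl refl = identity S w₁ Q₃
    where
    identity : ∀ S w₁ Q₃ → (ℕ→ℚ 2 * S + ℕ→ℚ 3) * ((S + ℕ→ℚ 3) * (S + ℕ→ℚ 3)) * (w₁ * (Q₃ * Q₃)) * (1ℚ + (1ℚ + S))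
      ≡ (ℕ→ℚ 2 * (1ℚ + S) + 1ℚ) * w₁ * (1ℚ + (1ℚ + S)) * (((1ℚ + (1ℚ + (1ℚ + S))) * Q₃) * ((1ℚ + (1ℚ + (1ℚ + S))) * Q₃))
    identity = solve-∀ ℚ-ring
  legendreSq-rec-rhs : ∀ S N₁ N₂ w₁ w₂ u Q₀ Q₁ Q₂ → N₁ ≡ 1ℚ + S → N₂ ≡ 1ℚ + N₁ → u ≡ w₁ * w₂ →
    let a′ = (ℕ→ℚ 2 * N₁ + 1ℚ) * w₁ ; a = (ℕ→ℚ 2 * N₂ + 1ℚ) * w₂ in
    (a′ * N₂ * a * a - a * N₂ * N₂ * N₂) * (Q₂ * Q₂) + (a′ * N₂ * N₂ * N₂ - a * N₂ * a′ * a′) * (Q₁ * Q₁) + a * N₂ * N₁ * N₁ * (Q₀ * Q₀)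
      ≡ (β u S * (w₂ * (Q₂ * Q₂)) + γ u S * (w₁ * (Q₁ * Q₁)) + δ S * (w₂ * (Q₀ * Q₀))) * N₂
  legendreSq-rec-rhs S _ _ w₁ w₂ _ Q₀ Q₁ Q₂ refl refl refl = identity S w₁ w₂ Q₀ Q₁ Q₂
    where
    identity : ∀ S w₁ w₂ Q₀ Q₁ Q₂ →
      (((ℕ→ℚ 2 * (1ℚ + S) + 1ℚ) * w₁) * (1ℚ + (1ℚ + S)) * ((ℕ→ℚ 2 * (1ℚ + (1ℚ + S)) + 1ℚ) * w₂) * ((ℕ→ℚ 2 * (1ℚ + (1ℚ + S)) + 1ℚ) * w₂) - ((ℕ→ℚ 2 * (1ℚ + (1ℚ + S)) + 1ℚ) * w₂) * (1ℚ + (1ℚ + S)) * (1ℚ + (1ℚ + S)) * (1ℚ + (1ℚ + S))) * (Q₂ * Q₂)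
        + (((ℕ→ℚ 2 * (1ℚ + S) + 1ℚ) * w₁) * (1ℚ + (1ℚ + S)) * (1ℚ + (1ℚ + S)) * (1ℚ + (1ℚ + S)) - ((ℕ→ℚ 2 * (1ℚ + (1ℚ + S)) + 1ℚ) * w₂) * (1ℚ + (1ℚ + S)) * ((ℕ→ℚ 2 * (1ℚ + S) + 1ℚ) * w₁) * ((ℕ→ℚ 2 * (1ℚ + S) + 1ℚ) * w₁)) * (Q₁ * Q₁) + ((ℕ→ℚ 2 * (1ℚ + (1ℚ + S)) + 1ℚ) * w₂) * (1ℚ + (1ℚ + S)) * (1ℚ + S) * (1ℚ + S) * (Q₀ * Q₀)
        ≡ (((ℕ→ℚ 2 * S + ℕ→ℚ 5) * ((ℕ→ℚ 2 * S + ℕ→ℚ 3) * (ℕ→ℚ 2 * S + ℕ→ℚ 5) * (w₁ * w₂) - (S + ℕ→ℚ 2) * (S + ℕ→ℚ 2))) * (w₂ * (Q₂ * Q₂)) + ((ℕ→ℚ 2 * S + ℕ→ℚ 3) * ((S + ℕ→ℚ 2) * (S + ℕ→ℚ 2) - (ℕ→ℚ 2 * S + ℕ→ℚ 3) * (ℕ→ℚ 2 * S + ℕ→ℚ 5) * (w₁ * w₂))) * (w₁ * (Q₁ * Q₁)) + ((ℕ→ℚ 2 * S + ℕ→ℚ 5) * ((S + 1ℚ) * (S + 1ℚ))) * (w₂ * (Q₀ * Q₀))) * (1ℚ + (1ℚ + S))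
    identity = solve-∀ ℚ-ring

-- Square Bonnet's recurrence for Q at s+1 and s+2; the two weights u^((s+1)%2) and u^((s+2)%2) multiply to u.
legendreSq-recurrent : ∀ u → Recurrent u (λ n → legendreSqAtSqrt n u)
legendreSq-recurrent u s = *-cancelʳ-≢0 N₂ (ℕ→ℚ-≢0 (suc (suc s))) (begin
    α S * A (3 ℕ.+ s) * N₂
      ≡⟨ cong (λ e → α S * (u ^ℚ e * (Q₃ * Q₃)) * N₂) ([2+n]%2≡n%2 (suc s)) ⟩
    α S * (w₁ * (Q₃ * Q₃)) * N₂
      ≡⟨ legendreSq-rec-lhs S N₁ N₂ N₃ w₁ Q₃ (ℕ→ℚ-suc s) (ℕ→ℚ-suc (suc s)) (ℕ→ℚ-suc (suc (suc s))) ⟩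
    a′ * N₂ * ((N₃ * Q₃) * (N₃ * Q₃))
      ≡⟨ square-recurrence a N₂ N₃ a′ N₁ N₂ Q₀ Q₁ Q₂ Q₃ (legendreQ-rec u s) (legendreQ-rec u (suc s)) ⟩
    (a′ * N₂ * a * a - a * N₂ * N₂ * N₂) * (Q₂ * Q₂) + (a′ * N₂ * N₂ * N₂ - a * N₂ * a′ * a′) * (Q₁ * Q₁) + a * N₂ * N₁ * N₁ * (Q₀ * Q₀)
      ≡⟨ legendreSq-rec-rhs S N₁ N₂ w₁ w₂ u Q₀ Q₁ Q₂ (ℕ→ℚ-suc s) (ℕ→ℚ-suc (suc s)) (sym (trans (ℚₚ.*-comm w₁ w₂) (u^[1+n]%2*u^n%2≡u u (suc s)))) ⟩
    (β u S * (w₂ * (Q₂ * Q₂)) + γ u S * (w₁ * (Q₁ * Q₁)) + δ S * (w₂ * (Q₀ * Q₀))) * N₂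
      ≡⟨ cong (λ e → (β u S * A (2 ℕ.+ s) + γ u S * A (suc s) + δ S * (u ^ℚ e * (Q₀ * Q₀))) * N₂) ([2+n]%2≡n%2 s) ⟩
    (β u S * A (2 ℕ.+ s) + γ u S * A (suc s) + δ S * A s) * N₂ ∎)
  where
  A : ℕ → ℚ
  A n = legendreSqAtSqrt n u
  S = ℕ→ℚ s
  N₁ = ℕ→ℚ (suc s)
  N₂ = ℕ→ℚ (suc (suc s))
  N₃ = ℕ→ℚ (suc (suc (suc s)))
  Q₀ = legendreQ s u
  Q₁ = legendreQ (suc s) u
  Q₂ = legendreQ (suc (suc s)) u
  Q₃ = legendreQ (suc (suc (suc s))) u
  w₁ = u ^ℚ (suc s % 2)
  w₂ = u ^ℚ (suc (suc s) % 2)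
  a′ = (ℕ→ℚ 2 * N₁ + 1ℚ) * w₁
  a = (ℕ→ℚ 2 * N₂ + 1ℚ) * w₂

binomialTerm : ℕ → ℕ → ℚ
binomialTerm n k = ℕ→ℚ ((n ℕ.+ k) C (2 ℕ.* k)) * (ℕ→ℚ ((2 ℕ.* k) C k) * ℕ→ℚ ((2 ℕ.* k) C k))

binomialSum : ℕ → ℚ → ℚ
binomialSum n t = sumTo n (λ k → binomialTerm n k * t ^ℚ k)

binomialTerm≡0 : ∀ {n k} → n ℕ.< k → binomialTerm n k ≡ 0ℚ
binomialTerm≡0 {n} {k} n<k = begin
  ℕ→ℚ ((n ℕ.+ k) C (2 ℕ.* k)) * E²   ≡⟨ cong (λ c → ℕ→ℚ c * E²) (k>n⇒nCk≡0 n+k<2k) ⟩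
  0ℚ * E²                            ≡⟨ ℚₚ.*-zeroˡ E² ⟩
  0ℚ                                 ∎
  where
  E² = ℕ→ℚ ((2 ℕ.* k) C k) * ℕ→ℚ ((2 ℕ.* k) C k)
  n+k<2k : n ℕ.+ k ℕ.< 2 ℕ.* k
  n+k<2k = subst (n ℕ.+ k ℕ.<_) (cong (k ℕ.+_) (sym (ℕₚ.+-identityʳ k))) (ℕₚ.+-monoˡ-< k n<k)

-- Zeilberger's certificate, termwise; the u-dependence of β and γ is split off as the delayed terms.
certificateRHS : ℚ → ℚ → ℚ → ℚ → ℚ → ℚ → ℚ
certificateRHS S x₂ x₁ x₀ y₂ y₁ =
  β 1ℚ S * x₂ + γ 1ℚ S * x₁ + δ S * x₀
    + ℕ→ℚ 4 * (ℕ→ℚ 2 * S + ℕ→ℚ 3) * (ℕ→ℚ 2 * S + ℕ→ℚ 5) * ((ℕ→ℚ 2 * S + ℕ→ℚ 5) * y₂ - (ℕ→ℚ 2 * S + ℕ→ℚ 3) * y₁)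

certificateRHS-cong : ∀ S {x₂ x₁ x₀ y₂ y₁ x₂′ x₁′ x₀′ y₂′ y₁′} →
  x₂ ≡ x₂′ → x₁ ≡ x₁′ → x₀ ≡ x₀′ → y₂ ≡ y₂′ → y₁ ≡ y₁′ →
  certificateRHS S x₂ x₁ x₀ y₂ y₁ ≡ certificateRHS S x₂′ x₁′ x₀′ y₂′ y₁′
certificateRHS-cong S refl refl refl refl refl = refl

Certificate : ℕ → ℕ → Set
Certificate s k = let T = binomialTerm in
  α (ℕ→ℚ s) * T (3 ℕ.+ s) k
    ≡ certificateRHS (ℕ→ℚ s) (T (2 ℕ.+ s) k) (T (1 ℕ.+ s) k) (T s k) (delay (T (2 ℕ.+ s)) k) (delay (T (1 ℕ.+ s)) k)

certificate₀ : ∀ s → Certificate s 0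
certificate₀ s = identity (ℕ→ℚ s)
  where
  identity : ∀ S →
    (ℕ→ℚ 2 * S + ℕ→ℚ 3) * ((S + ℕ→ℚ 3) * (S + ℕ→ℚ 3)) * (1ℚ * (1ℚ * 1ℚ))
      ≡ (ℕ→ℚ 2 * S + ℕ→ℚ 5) * ((ℕ→ℚ 2 * S + ℕ→ℚ 3) * (ℕ→ℚ 2 * S + ℕ→ℚ 5) * 1ℚ - (S + ℕ→ℚ 2) * (S + ℕ→ℚ 2)) * (1ℚ * (1ℚ * 1ℚ))
        + (ℕ→ℚ 2 * S + ℕ→ℚ 3) * ((S + ℕ→ℚ 2) * (S + ℕ→ℚ 2) - (ℕ→ℚ 2 * S + ℕ→ℚ 3) * (ℕ→ℚ 2 * S + ℕ→ℚ 5) * 1ℚ) * (1ℚ * (1ℚ * 1ℚ))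
        + (ℕ→ℚ 2 * S + ℕ→ℚ 5) * ((S + 1ℚ) * (S + 1ℚ)) * (1ℚ * (1ℚ * 1ℚ))
        + ℕ→ℚ 4 * (ℕ→ℚ 2 * S + ℕ→ℚ 3) * (ℕ→ℚ 2 * S + ℕ→ℚ 5) * ((ℕ→ℚ 2 * S + ℕ→ℚ 5) * 0ℚ - (ℕ→ℚ 2 * S + ℕ→ℚ 3) * 0ℚ)
  identity = solve-∀ ℚ-ring

binomialTerm-1 : ∀ n → binomialTerm n 1 ≡ ℕ→ℚ 2 * ((1ℚ + ℕ→ℚ n) * ℕ→ℚ n)
binomialTerm-1 n = begin
  ℕ→ℚ ((n ℕ.+ 1) C 2) * (ℕ→ℚ 2 * ℕ→ℚ 2)      ≡⟨ cong (λ m → ℕ→ℚ (m C 2) * (ℕ→ℚ 2 * ℕ→ℚ 2)) (ℕₚ.+-comm n 1) ⟩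
  ℕ→ℚ (suc n C 2) * (ℕ→ℚ 2 * ℕ→ℚ 2)          ≡⟨ ℚₚ.*-assoc (ℕ→ℚ (suc n C 2)) (ℕ→ℚ 2) (ℕ→ℚ 2) ⟨
  ℕ→ℚ (suc n C 2) * ℕ→ℚ 2 * ℕ→ℚ 2            ≡⟨ cong (_* ℕ→ℚ 2) ([n+1]C[k+1]*[k+1]≡[n+1]*nCk n 1) ⟩
  ℕ→ℚ (suc n) * ℕ→ℚ (n C 1) * ℕ→ℚ 2          ≡⟨ cong₂ (λ a b → a * ℕ→ℚ b * ℕ→ℚ 2) (ℕ→ℚ-suc n) (nC1≡n n) ⟩
  (1ℚ + ℕ→ℚ n) * ℕ→ℚ n * ℕ→ℚ 2               ≡⟨ ℚₚ.*-comm ((1ℚ + ℕ→ℚ n) * ℕ→ℚ n) (ℕ→ℚ 2) ⟩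
  ℕ→ℚ 2 * ((1ℚ + ℕ→ℚ n) * ℕ→ℚ n)             ∎

certificate₁ : ∀ s → Certificate s 1
certificate₁ s = begin
  α S * T (3 ℕ.+ s) 1                                   ≡⟨ cong (α S *_) (T₁ 3) ⟩
  α S * t (ℕ→ℚ 3)                                       ≡⟨ identity S ⟩
  certificateRHS S (t (ℕ→ℚ 2)) (t 1ℚ) (t 0ℚ) 1ℚ 1ℚ      ≡⟨ certificateRHS-cong S (T₁ 2) (T₁ 1) T₁0 refl refl ⟨
  certificateRHS S (T (2 ℕ.+ s) 1) (T (1 ℕ.+ s) 1) (T s 1) 1ℚ 1ℚ ∎
  where
  S = ℕ→ℚ s
  T = binomialTerm
  t : ℚ → ℚ
  t a = ℕ→ℚ 2 * ((1ℚ + (a + S)) * (a + S))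
  T₁ : ∀ a → T (a ℕ.+ s) 1 ≡ t (ℕ→ℚ a)
  T₁ a = trans (binomialTerm-1 (a ℕ.+ s)) (cong (λ x → ℕ→ℚ 2 * ((1ℚ + x) * x)) (ℕ→ℚ-+ a s))
  T₁0 : T s 1 ≡ t 0ℚ
  T₁0 = trans (binomialTerm-1 s) (cong (λ x → ℕ→ℚ 2 * ((1ℚ + x) * x)) (sym (ℚₚ.+-identityˡ S)))
  identity : ∀ S →
    (ℕ→ℚ 2 * S + ℕ→ℚ 3) * ((S + ℕ→ℚ 3) * (S + ℕ→ℚ 3)) * (ℕ→ℚ 2 * ((1ℚ + (ℕ→ℚ 3 + S)) * (ℕ→ℚ 3 + S)))
      ≡ (ℕ→ℚ 2 * S + ℕ→ℚ 5) * ((ℕ→ℚ 2 * S + ℕ→ℚ 3) * (ℕ→ℚ 2 * S + ℕ→ℚ 5) * 1ℚ - (S + ℕ→ℚ 2) * (S + ℕ→ℚ 2)) * (ℕ→ℚ 2 * ((1ℚ + (ℕ→ℚ 2 + S)) * (ℕ→ℚ 2 + S)))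
        + (ℕ→ℚ 2 * S + ℕ→ℚ 3) * ((S + ℕ→ℚ 2) * (S + ℕ→ℚ 2) - (ℕ→ℚ 2 * S + ℕ→ℚ 3) * (ℕ→ℚ 2 * S + ℕ→ℚ 5) * 1ℚ) * (ℕ→ℚ 2 * ((1ℚ + (1ℚ + S)) * (1ℚ + S)))
        + (ℕ→ℚ 2 * S + ℕ→ℚ 5) * ((S + 1ℚ) * (S + 1ℚ)) * (ℕ→ℚ 2 * ((1ℚ + (0ℚ + S)) * (0ℚ + S)))
        + ℕ→ℚ 4 * (ℕ→ℚ 2 * S + ℕ→ℚ 3) * (ℕ→ℚ 2 * S + ℕ→ℚ 5) * ((ℕ→ℚ 2 * S + ℕ→ℚ 5) * 1ℚ - (ℕ→ℚ 2 * S + ℕ→ℚ 3) * 1ℚ)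
  identity = solve-∀ ℚ-ring

↓-window : ∀ y u l d → (y + ℕ→ℚ u) ↓ (u ℕ.+ (l ℕ.+ d)) ≡ (y + ℕ→ℚ u) ↓ u * (y ↓ l * (y - ℕ→ℚ l) ↓ d)
↓-window y u l d = begin
  (y + ℕ→ℚ u) ↓ (u ℕ.+ (l ℕ.+ d))                    ≡⟨ ↓-+ (y + ℕ→ℚ u) u (l ℕ.+ d) ⟩
  (y + ℕ→ℚ u) ↓ u * (y + ℕ→ℚ u - ℕ→ℚ u) ↓ (l ℕ.+ d)  ≡⟨ cong (λ x → (y + ℕ→ℚ u) ↓ u * x ↓ (l ℕ.+ d)) (cancel y (ℕ→ℚ u)) ⟩
  (y + ℕ→ℚ u) ↓ u * y ↓ (l ℕ.+ d)                    ≡⟨ cong ((y + ℕ→ℚ u) ↓ u *_) (↓-+ y l d) ⟩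
  (y + ℕ→ℚ u) ↓ u * (y ↓ l * (y - ℕ→ℚ l) ↓ d)        ∎
  where
  cancel : ∀ y u → y + u - u ≡ y
  cancel = solve-∀ ℚ-ring

certificate-identity : ∀ S I E core →
  (ℕ→ℚ 2 * S + ℕ→ℚ 3) * ((S + ℕ→ℚ 3) * (S + ℕ→ℚ 3))
      * ((((S + (1ℚ + (1ℚ + I))) + ℕ→ℚ 3) * ((((S + (1ℚ + (1ℚ + I))) + ℕ→ℚ 3) - 1ℚ) * (((((S + (1ℚ + (1ℚ + I))) + ℕ→ℚ 3) - 1ℚ) - 1ℚ) * 1ℚ)))
         * (core * 1ℚ) * (((ℕ→ℚ 2 * (1ℚ + ℕ→ℚ 2 * (1ℚ + I))) * E) * ((ℕ→ℚ 2 * (1ℚ + ℕ→ℚ 2 * (1ℚ + I))) * E)))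
    ≡ (ℕ→ℚ 2 * S + ℕ→ℚ 5) * ((ℕ→ℚ 2 * S + ℕ→ℚ 3) * (ℕ→ℚ 2 * S + ℕ→ℚ 5) * 1ℚ - (S + ℕ→ℚ 2) * (S + ℕ→ℚ 2))
      * ((((S + (1ℚ + (1ℚ + I))) + ℕ→ℚ 2) * ((((S + (1ℚ + (1ℚ + I))) + ℕ→ℚ 2) - 1ℚ) * 1ℚ))
         * (core * (((S + (1ℚ + (1ℚ + I))) - (1ℚ + ℕ→ℚ 2 * I)) * 1ℚ)) * (((ℕ→ℚ 2 * (1ℚ + ℕ→ℚ 2 * (1ℚ + I))) * E) * ((ℕ→ℚ 2 * (1ℚ + ℕ→ℚ 2 * (1ℚ + I))) * E)))
    + (ℕ→ℚ 2 * S + ℕ→ℚ 3) * ((S + ℕ→ℚ 2) * (S + ℕ→ℚ 2) - (ℕ→ℚ 2 * S + ℕ→ℚ 3) * (ℕ→ℚ 2 * S + ℕ→ℚ 5) * 1ℚ)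
      * ((((S + (1ℚ + (1ℚ + I))) + ℕ→ℚ 1) * 1ℚ)
         * (core * (((S + (1ℚ + (1ℚ + I))) - (1ℚ + ℕ→ℚ 2 * I)) * ((((S + (1ℚ + (1ℚ + I))) - (1ℚ + ℕ→ℚ 2 * I)) - 1ℚ) * 1ℚ))) * (((ℕ→ℚ 2 * (1ℚ + ℕ→ℚ 2 * (1ℚ + I))) * E) * ((ℕ→ℚ 2 * (1ℚ + ℕ→ℚ 2 * (1ℚ + I))) * E)))
    + (ℕ→ℚ 2 * S + ℕ→ℚ 5) * ((S + 1ℚ) * (S + 1ℚ))
      * (1ℚ
         * (core * (((S + (1ℚ + (1ℚ + I))) - (1ℚ + ℕ→ℚ 2 * I)) * ((((S + (1ℚ + (1ℚ + I))) - (1ℚ + ℕ→ℚ 2 * I)) - 1ℚ) * (((((S + (1ℚ + (1ℚ + I))) - (1ℚ + ℕ→ℚ 2 * I)) - 1ℚ) - 1ℚ) * 1ℚ)))) * (((ℕ→ℚ 2 * (1ℚ + ℕ→ℚ 2 * (1ℚ + I))) * E) * ((ℕ→ℚ 2 * (1ℚ + ℕ→ℚ 2 * (1ℚ + I))) * E)))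
    + ℕ→ℚ 4 * (ℕ→ℚ 2 * S + ℕ→ℚ 3) * (ℕ→ℚ 2 * S + ℕ→ℚ 5)
      * ((ℕ→ℚ 2 * S + ℕ→ℚ 5) * ((((S + (1ℚ + (1ℚ + I))) + ℕ→ℚ 1) * 1ℚ) * (core * 1ℚ) * (E * E) * ((1ℚ + (1ℚ + ℕ→ℚ 2 * (1ℚ + I))) * (1ℚ + ℕ→ℚ 2 * (1ℚ + I)) * (1ℚ + (1ℚ + I)) * (1ℚ + (1ℚ + I))))
         - (ℕ→ℚ 2 * S + ℕ→ℚ 3) * (1ℚ * (core * (((S + (1ℚ + (1ℚ + I))) - (1ℚ + ℕ→ℚ 2 * I)) * 1ℚ)) * (E * E) * ((1ℚ + (1ℚ + ℕ→ℚ 2 * (1ℚ + I))) * (1ℚ + ℕ→ℚ 2 * (1ℚ + I)) * (1ℚ + (1ℚ + I)) * (1ℚ + (1ℚ + I)))))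
certificate-identity = solve-∀ ℚ-ring

module _ (s i : ℕ) where
  private
    k = suc (suc i)
    m = 2 ℕ.* suc i
    L = suc (2 ℕ.* i)
    S = ℕ→ℚ s
    I = ℕ→ℚ i
    T = binomialTerm
    E₀ = ℕ→ℚ (m C suc i)
    M = ℕ→ℚ ((2 ℕ.* k) !) * ℕ→ℚ k * ℕ→ℚ k
    K′ = 1ℚ + (1ℚ + I)
    m′ = 1ℚ + ℕ→ℚ 2 * (1ℚ + I)
    Y = S + K′
    core = Y ↓ L
    RE = ℕ→ℚ 2 * m′ * E₀
    W = (1ℚ + m′) * m′ * K′ * K′

    top : ℕ → ℚ
    top u = (Y + ℕ→ℚ u) ↓ u
    tail : ℕ → ℚ
    tail d = (Y - (1ℚ + ℕ→ℚ 2 * I)) ↓ d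

    K≡ : ℕ→ℚ k ≡ K′
    K≡ = trans (ℕ→ℚ-suc (suc i)) (cong (1ℚ +_) (ℕ→ℚ-suc i))
    m≡ : ℕ→ℚ (suc m) ≡ m′
    m≡ = trans (ℕ→ℚ-suc m) (cong (1ℚ +_) (trans (ℕ→ℚ-* 2 (suc i)) (cong (ℕ→ℚ 2 *_) (ℕ→ℚ-suc i))))

    shuffle : ∀ u s k → u ℕ.+ s ℕ.+ k ≡ s ℕ.+ k ℕ.+ u
    shuffle = ℕ-Solver.solve-∀
    shuffle′ : ∀ u s i → suc u ℕ.+ s ℕ.+ suc i ≡ s ℕ.+ suc (suc i) ℕ.+ u
    shuffle′ = ℕ-Solver.solve-∀

    window : ∀ N u d → N ≡ s ℕ.+ k ℕ.+ u → ∀ len → len ≡ u ℕ.+ (L ℕ.+ d) → ℕ→ℚ N ↓ len ≡ top u * (core * tail d)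
    window _ u d refl _ refl = begin
      ℕ→ℚ (s ℕ.+ k ℕ.+ u) ↓ (u ℕ.+ (L ℕ.+ d))        ≡⟨ cong (_↓ (u ℕ.+ (L ℕ.+ d))) cast ⟩
      (Y + ℕ→ℚ u) ↓ (u ℕ.+ (L ℕ.+ d))                ≡⟨ ↓-window Y u L d ⟩
      top u * (core * (Y - ℕ→ℚ L) ↓ d)               ≡⟨ cong (λ x → top u * (core * (Y - x) ↓ d)) (trans (ℕ→ℚ-suc (2 ℕ.* i)) (cong (1ℚ +_) (ℕ→ℚ-* 2 i))) ⟩
      top u * (core * tail d)                        ∎
      where
      cast : ℕ→ℚ (s ℕ.+ k ℕ.+ u) ≡ Y + ℕ→ℚ u
      cast = trans (ℕ→ℚ-+ (s ℕ.+ k) u) (cong (_+ ℕ→ℚ u) (trans (ℕ→ℚ-+ s k) (cong (S +_) K≡)))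

    scaled-term : ∀ u d → 2 ℕ.* k ≡ u ℕ.+ (L ℕ.+ d) → T (u ℕ.+ s) k * M ≡ top u * (core * tail d) * (RE * RE)
    scaled-term u d len≡ = begin
      ℕ→ℚ C₁ * (E * E) * (F * ℕ→ℚ k * ℕ→ℚ k)          ≡⟨ regroup (ℕ→ℚ C₁) E F (ℕ→ℚ k) ⟩
      ℕ→ℚ C₁ * F * ((E * ℕ→ℚ k) * (E * ℕ→ℚ k))        ≡⟨ cong₂ (λ x y → x * (y * y)) (C*!≡↓ ((u ℕ.+ s) ℕ.+ k) (2 ℕ.* k)) ([2k+2]C[k+1]*[k+1]≡2[2k+1]*[2k]Ck (suc i)) ⟩
      ℕ→ℚ ((u ℕ.+ s) ℕ.+ k) ↓ (2 ℕ.* k) * (R * R)      ≡⟨ cong₂ (λ x y → x * (y * y)) (window ((u ℕ.+ s) ℕ.+ k) u d (shuffle u s k) (2 ℕ.* k) len≡) (cong (λ x → ℕ→ℚ 2 * x * E₀) m≡) ⟩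
      top u * (core * tail d) * (RE * RE)              ∎
      where
      C₁ = ((u ℕ.+ s) ℕ.+ k) C (2 ℕ.* k)
      E = ℕ→ℚ ((2 ℕ.* k) C k)
      F = ℕ→ℚ ((2 ℕ.* k) !)
      R = ℕ→ℚ 2 * ℕ→ℚ (suc m) * E₀
      regroup : ∀ c e f k → c * (e * e) * (f * k * k) ≡ c * f * ((e * k) * (e * k))
      regroup = solve-∀ ℚ-ring

    scaled-delayed : ∀ u d → m ≡ u ℕ.+ (L ℕ.+ d) → T (suc u ℕ.+ s) (suc i) * M ≡ top u * (core * tail d) * (E₀ * E₀) * W
    scaled-delayed u d len≡ = begin
      ℕ→ℚ C₀ * (E₀ * E₀) * (ℕ→ℚ ((2 ℕ.* k) !) * ℕ→ℚ k * ℕ→ℚ k)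
        ≡⟨ cong (λ x → ℕ→ℚ C₀ * (E₀ * E₀) * (ℕ→ℚ (x !) * ℕ→ℚ k * ℕ→ℚ k)) (ℕₚ.*-suc 2 (suc i)) ⟩
      ℕ→ℚ C₀ * (E₀ * E₀) * (ℕ→ℚ (suc (suc m) ℕ.* (suc m ℕ.* m !)) * ℕ→ℚ k * ℕ→ℚ k)
        ≡⟨ cong (λ x → ℕ→ℚ C₀ * (E₀ * E₀) * (x * ℕ→ℚ k * ℕ→ℚ k)) (trans (ℕ→ℚ-* (suc (suc m)) (suc m ℕ.* m !)) (cong (ℕ→ℚ (suc (suc m)) *_) (ℕ→ℚ-* (suc m) (m !)))) ⟩
      ℕ→ℚ C₀ * (E₀ * E₀) * (ℕ→ℚ (suc (suc m)) * (ℕ→ℚ (suc m) * ℕ→ℚ (m !)) * ℕ→ℚ k * ℕ→ℚ k)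
        ≡⟨ regroup (ℕ→ℚ C₀) E₀ (ℕ→ℚ (m !)) (ℕ→ℚ (suc m)) (ℕ→ℚ (suc (suc m))) (ℕ→ℚ k) ⟩
      ℕ→ℚ C₀ * ℕ→ℚ (m !) * (E₀ * E₀) * (ℕ→ℚ (suc (suc m)) * ℕ→ℚ (suc m) * ℕ→ℚ k * ℕ→ℚ k)
        ≡⟨ cong₂ (λ x y → x * (E₀ * E₀) * y) (trans (C*!≡↓ ((suc u ℕ.+ s) ℕ.+ suc i) m) (window ((suc u ℕ.+ s) ℕ.+ suc i) u d (shuffle′ u s i) m len≡)) W≡ ⟩
      top u * (core * tail d) * (E₀ * E₀) * W ∎
      where
      C₀ = ((suc u ℕ.+ s) ℕ.+ suc i) C m
      W≡ : ℕ→ℚ (suc (suc m)) * ℕ→ℚ (suc m) * ℕ→ℚ k * ℕ→ℚ k ≡ W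
      W≡ = cong₂ (λ x y → x * y * y) (cong₂ _*_ (trans (ℕ→ℚ-suc (suc m)) (cong (1ℚ +_) m≡)) m≡) K≡
      regroup : ∀ c e f m₁ m₂ k → c * (e * e) * (m₂ * (m₁ * f) * k * k) ≡ c * f * (e * e) * (m₂ * m₁ * k * k)
      regroup = solve-∀ ℚ-ring

  -- Scaled by M = (2k)! k², all six terms are multiples of the common window core = (s+k)↓(2k−3).
  certificate₂₊ : Certificate s (suc (suc i))
  certificate₂₊ = *-cancelʳ-≢0 M M≢0 (begin
      α S * T (3 ℕ.+ s) k * M
        ≡⟨ ℚₚ.*-assoc (α S) (T (3 ℕ.+ s) k) M ⟩
      α S * (T (3 ℕ.+ s) k * M)
        ≡⟨ cong (α S *_) (scaled-term 3 0 (len₃ i)) ⟩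
      α S * (top 3 * (core * tail 0) * (RE * RE))
        ≡⟨ certificate-identity S I E₀ core ⟩
      certificateRHS S (top 2 * (core * tail 1) * (RE * RE)) (top 1 * (core * tail 2) * (RE * RE)) (top 0 * (core * tail 3) * (RE * RE))
                       (top 1 * (core * tail 0) * (E₀ * E₀) * W) (top 0 * (core * tail 1) * (E₀ * E₀) * W)
        ≡⟨ certificateRHS-cong S (scaled-term 2 1 (len₂ i)) (scaled-term 1 2 (len₁ i)) (scaled-term 0 3 (len₀ i))
                                 (scaled-delayed 1 0 (len₁′ i)) (scaled-delayed 0 1 (len₀′ i)) ⟨
      certificateRHS S (T (2 ℕ.+ s) k * M) (T (1 ℕ.+ s) k * M) (T s k * M) (T (2 ℕ.+ s) (suc i) * M) (T (1 ℕ.+ s) (suc i) * M)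
        ≡⟨ distribute (β 1ℚ S) (γ 1ℚ S) (δ S) (ℕ→ℚ 4 * (ℕ→ℚ 2 * S + ℕ→ℚ 3) * (ℕ→ℚ 2 * S + ℕ→ℚ 5)) (ℕ→ℚ 2 * S + ℕ→ℚ 5) (ℕ→ℚ 2 * S + ℕ→ℚ 3)
             (T (2 ℕ.+ s) k) (T (1 ℕ.+ s) k) (T s k) (T (2 ℕ.+ s) (suc i)) (T (1 ℕ.+ s) (suc i)) M ⟨
      certificateRHS S (T (2 ℕ.+ s) k) (T (1 ℕ.+ s) k) (T s k) (T (2 ℕ.+ s) (suc i)) (T (1 ℕ.+ s) (suc i)) * M ∎)
    where
    M≢0 : M ≢ 0ℚ
    M≢0 = *-≢0 (*-≢0 (ℕ→ℚ-≢0 ((2 ℕ.* k) !) {{ℕₚ._!≢0 (2 ℕ.* k)}}) (ℕ→ℚ-≢0 k)) (ℕ→ℚ-≢0 k)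
    distribute : ∀ b g d c e f x y z v w M →
      (b * x + g * y + d * z + c * (e * v - f * w)) * M ≡ b * (x * M) + g * (y * M) + d * (z * M) + c * (e * (v * M) - f * (w * M))
    distribute = solve-∀ ℚ-ring
    len₃ : ∀ i → 2 ℕ.* suc (suc i) ≡ 3 ℕ.+ (suc (2 ℕ.* i) ℕ.+ 0)
    len₃ = ℕ-Solver.solve-∀
    len₂ : ∀ i → 2 ℕ.* suc (suc i) ≡ 2 ℕ.+ (suc (2 ℕ.* i) ℕ.+ 1)
    len₂ = ℕ-Solver.solve-∀
    len₁ : ∀ i → 2 ℕ.* suc (suc i) ≡ 1 ℕ.+ (suc (2 ℕ.* i) ℕ.+ 2)
    len₁ = ℕ-Solver.solve-∀
    len₀ : ∀ i → 2 ℕ.* suc (suc i) ≡ 0 ℕ.+ (suc (2 ℕ.* i) ℕ.+ 3)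
    len₀ = ℕ-Solver.solve-∀
    len₁′ : ∀ i → 2 ℕ.* suc i ≡ 1 ℕ.+ (suc (2 ℕ.* i) ℕ.+ 0)
    len₁′ = ℕ-Solver.solve-∀
    len₀′ : ∀ i → 2 ℕ.* suc i ≡ 0 ℕ.+ (suc (2 ℕ.* i) ℕ.+ 1)
    len₀′ = ℕ-Solver.solve-∀

certificate : ∀ s k → Certificate s k
certificate s zero = certificate₀ s
certificate s (suc zero) = certificate₁ s
certificate s (suc (suc i)) = certificate₂₊ s i

sumTo-+-*ˡ : ∀ n a f g → sumTo n (λ k → f k + a * g k) ≡ sumTo n f + a * sumTo n g
sumTo-+-*ˡ n a f g = trans (sumTo-+ n f (λ k → a * g k)) (cong (sumTo n f +_) (sumTo-*ˡ n a g))

sumTo-linear₅ : ∀ n a₁ a₂ a₃ a₄ a₅ f₁ f₂ f₃ f₄ f₅ →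
  sumTo n (λ k → a₁ * f₁ k + a₂ * f₂ k + a₃ * f₃ k + a₄ * f₄ k + a₅ * f₅ k)
    ≡ a₁ * sumTo n f₁ + a₂ * sumTo n f₂ + a₃ * sumTo n f₃ + a₄ * sumTo n f₄ + a₅ * sumTo n f₅
sumTo-linear₅ n a₁ a₂ a₃ a₄ a₅ f₁ f₂ f₃ f₄ f₅ = begin
  sumTo n (λ k → a₁ * f₁ k + a₂ * f₂ k + a₃ * f₃ k + a₄ * f₄ k + a₅ * f₅ k)
    ≡⟨ sumTo-+-*ˡ n a₅ (λ k → a₁ * f₁ k + a₂ * f₂ k + a₃ * f₃ k + a₄ * f₄ k) f₅ ⟩
  sumTo n (λ k → a₁ * f₁ k + a₂ * f₂ k + a₃ * f₃ k + a₄ * f₄ k) + a₅ * ∑ f₅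
    ≡⟨ cong (_+ a₅ * ∑ f₅) (sumTo-+-*ˡ n a₄ (λ k → a₁ * f₁ k + a₂ * f₂ k + a₃ * f₃ k) f₄) ⟩
  sumTo n (λ k → a₁ * f₁ k + a₂ * f₂ k + a₃ * f₃ k) + a₄ * ∑ f₄ + a₅ * ∑ f₅
    ≡⟨ cong (λ x → x + a₄ * ∑ f₄ + a₅ * ∑ f₅) (sumTo-+-*ˡ n a₃ (λ k → a₁ * f₁ k + a₂ * f₂ k) f₃) ⟩
  sumTo n (λ k → a₁ * f₁ k + a₂ * f₂ k) + a₃ * ∑ f₃ + a₄ * ∑ f₄ + a₅ * ∑ f₅
    ≡⟨ cong (λ x → x + a₃ * ∑ f₃ + a₄ * ∑ f₄ + a₅ * ∑ f₅) (trans (sumTo-+-*ˡ n a₂ (λ k → a₁ * f₁ k) f₂) (cong (_+ a₂ * ∑ f₂) (sumTo-*ˡ n a₁ f₁))) ⟩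
  a₁ * ∑ f₁ + a₂ * ∑ f₂ + a₃ * ∑ f₃ + a₄ * ∑ f₄ + a₅ * ∑ f₅ ∎
  where
  ∑ : (ℕ → ℚ) → ℚ
  ∑ = sumTo n

sumTo-delay : ∀ n c t → sumTo (suc n) (λ k → delay c k * t ^ℚ k) ≡ t * sumTo n (λ k → c k * t ^ℚ k)
sumTo-delay n c t = begin
  sumTo (suc n) (λ k → delay c k * t ^ℚ k)     ≡⟨ sumTo-suc n (λ k → delay c k * t ^ℚ k) ⟩
  0ℚ * 1ℚ + sumTo n (λ k → c k * t ^ℚ suc k)   ≡⟨ ℚₚ.+-identityˡ _ ⟩
  sumTo n (λ k → c k * (t * t ^ℚ k))           ≡⟨ sumTo-cong n (λ k _ → swap (c k) t (t ^ℚ k)) ⟩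
  sumTo n (λ k → t * (c k * t ^ℚ k))           ≡⟨ sumTo-*ˡ n t (λ k → c k * t ^ℚ k) ⟩
  t * sumTo n (λ k → c k * t ^ℚ k)             ∎
  where
  swap : ∀ c t w → c * (t * w) ≡ t * (c * w)
  swap = solve-∀ ℚ-ring

binomialSum-extend : ∀ n d t → sumTo (d ℕ.+ n) (λ k → binomialTerm n k * t ^ℚ k) ≡ binomialSum n t
binomialSum-extend n d t = sumTo-extend n d (λ k → binomialTerm n k * t ^ℚ k)
  (λ k n<k → trans (cong (_* t ^ℚ k) (binomialTerm≡0 n<k)) (ℚₚ.*-zeroˡ (t ^ℚ k)))

certificateRHS-affine : ∀ S t F₂ F₁ F₀ →
  certificateRHS S F₂ F₁ F₀ (t * F₂) (t * F₁) ≡ β (1ℚ + ℕ→ℚ 4 * t) S * F₂ + γ (1ℚ + ℕ→ℚ 4 * t) S * F₁ + δ S * F₀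
certificateRHS-affine S t F₂ F₁ F₀ = trans (regroup (β 1ℚ S) (γ 1ℚ S) (δ S) (ℕ→ℚ 4 * (ℕ→ℚ 2 * S + ℕ→ℚ 3) * (ℕ→ℚ 2 * S + ℕ→ℚ 5))
                                                     (ℕ→ℚ 2 * S + ℕ→ℚ 5) (ℕ→ℚ 2 * S + ℕ→ℚ 3) F₂ F₁ F₀ t) (identity S t F₂ F₁ F₀)
  where
  regroup : ∀ b g d c e₂ e₁ F₂ F₁ F₀ t →
    b * F₂ + g * F₁ + d * F₀ + c * (e₂ * (t * F₂) - e₁ * (t * F₁)) ≡ b * F₂ + g * F₁ + d * F₀ + c * e₂ * (t * F₂) + - (c * e₁) * (t * F₁)
  regroup = solve-∀ ℚ-ring
  identity : ∀ S t F₂ F₁ F₀ →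
    ((ℕ→ℚ 2 * S + ℕ→ℚ 5) * ((ℕ→ℚ 2 * S + ℕ→ℚ 3) * (ℕ→ℚ 2 * S + ℕ→ℚ 5) * 1ℚ - (S + ℕ→ℚ 2) * (S + ℕ→ℚ 2))) * F₂ + ((ℕ→ℚ 2 * S + ℕ→ℚ 3) * ((S + ℕ→ℚ 2) * (S + ℕ→ℚ 2) - (ℕ→ℚ 2 * S + ℕ→ℚ 3) * (ℕ→ℚ 2 * S + ℕ→ℚ 5) * 1ℚ)) * F₁ + ((ℕ→ℚ 2 * S + ℕ→ℚ 5) * ((S + 1ℚ) * (S + 1ℚ))) * F₀
      + ℕ→ℚ 4 * (ℕ→ℚ 2 * S + ℕ→ℚ 3) * (ℕ→ℚ 2 * S + ℕ→ℚ 5) * (ℕ→ℚ 2 * S + ℕ→ℚ 5) * (t * F₂) + - (ℕ→ℚ 4 * (ℕ→ℚ 2 * S + ℕ→ℚ 3) * (ℕ→ℚ 2 * S + ℕ→ℚ 5) * (ℕ→ℚ 2 * S + ℕ→ℚ 3)) * (t * F₁)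
      ≡ ((ℕ→ℚ 2 * S + ℕ→ℚ 5) * ((ℕ→ℚ 2 * S + ℕ→ℚ 3) * (ℕ→ℚ 2 * S + ℕ→ℚ 5) * (1ℚ + ℕ→ℚ 4 * t) - (S + ℕ→ℚ 2) * (S + ℕ→ℚ 2))) * F₂ + ((ℕ→ℚ 2 * S + ℕ→ℚ 3) * ((S + ℕ→ℚ 2) * (S + ℕ→ℚ 2) - (ℕ→ℚ 2 * S + ℕ→ℚ 3) * (ℕ→ℚ 2 * S + ℕ→ℚ 5) * (1ℚ + ℕ→ℚ 4 * t))) * F₁ + ((ℕ→ℚ 2 * S + ℕ→ℚ 5) * ((S + 1ℚ) * (S + 1ℚ))) * F₀
  identity = solve-∀ ℚ-ring

binomialSum-recurrent : ∀ t → Recurrent (1ℚ + ℕ→ℚ 4 * t) (λ n → binomialSum n t)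
binomialSum-recurrent t s = begin
  α S * F (3 ℕ.+ s)
    ≡⟨ sumTo-*ˡ (3 ℕ.+ s) (α S) (λ k → T (3 ℕ.+ s) k * t ^ℚ k) ⟨
  sumTo (3 ℕ.+ s) (λ k → α S * (T (3 ℕ.+ s) k * t ^ℚ k))
    ≡⟨ sumTo-cong (3 ℕ.+ s) (λ k _ → termwise k) ⟩
  sumTo (3 ℕ.+ s) (λ k → b * f₂ k + g * f₁ k + d * f₀ k + (c * e₂) * f₂′ k + (- (c * e₁)) * f₁′ k)
    ≡⟨ sumTo-linear₅ (3 ℕ.+ s) b g d (c * e₂) (- (c * e₁)) f₂ f₁ f₀ f₂′ f₁′ ⟩
  b * sumTo (3 ℕ.+ s) f₂ + g * sumTo (3 ℕ.+ s) f₁ + d * sumTo (3 ℕ.+ s) f₀ + c * e₂ * sumTo (3 ℕ.+ s) f₂′ + - (c * e₁) * sumTo (3 ℕ.+ s) f₁′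
    ≡⟨ regroup b g d c e₂ e₁ (sumTo (3 ℕ.+ s) f₂) (sumTo (3 ℕ.+ s) f₁) (sumTo (3 ℕ.+ s) f₀) (sumTo (3 ℕ.+ s) f₂′) (sumTo (3 ℕ.+ s) f₁′) ⟩
  certificateRHS S (sumTo (3 ℕ.+ s) f₂) (sumTo (3 ℕ.+ s) f₁) (sumTo (3 ℕ.+ s) f₀) (sumTo (3 ℕ.+ s) f₂′) (sumTo (3 ℕ.+ s) f₁′)
    ≡⟨ certificateRHS-cong S (binomialSum-extend (2 ℕ.+ s) 1 t) (binomialSum-extend (1 ℕ.+ s) 2 t) (binomialSum-extend s 3 t)
         (sumTo-delay (2 ℕ.+ s) (T (2 ℕ.+ s)) t) (trans (sumTo-delay (2 ℕ.+ s) (T (1 ℕ.+ s)) t) (cong (t *_) (binomialSum-extend (1 ℕ.+ s) 1 t))) ⟩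
  certificateRHS S (F (2 ℕ.+ s)) (F (1 ℕ.+ s)) (F s) (t * F (2 ℕ.+ s)) (t * F (1 ℕ.+ s))
    ≡⟨ certificateRHS-affine S t (F (2 ℕ.+ s)) (F (1 ℕ.+ s)) (F s) ⟩
  β (1ℚ + ℕ→ℚ 4 * t) S * F (2 ℕ.+ s) + γ (1ℚ + ℕ→ℚ 4 * t) S * F (1 ℕ.+ s) + δ S * F s ∎
  where
  S = ℕ→ℚ s
  T = binomialTerm
  F : ℕ → ℚ
  F n = binomialSum n t
  b = β 1ℚ S
  g = γ 1ℚ S
  d = δ S
  c = ℕ→ℚ 4 * (ℕ→ℚ 2 * S + ℕ→ℚ 3) * (ℕ→ℚ 2 * S + ℕ→ℚ 5)
  e₂ = ℕ→ℚ 2 * S + ℕ→ℚ 5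
  e₁ = ℕ→ℚ 2 * S + ℕ→ℚ 3
  f₂ f₁ f₀ f₂′ f₁′ : ℕ → ℚ
  f₂ k = T (2 ℕ.+ s) k * t ^ℚ k
  f₁ k = T (1 ℕ.+ s) k * t ^ℚ k
  f₀ k = T s k * t ^ℚ k
  f₂′ k = delay (T (2 ℕ.+ s)) k * t ^ℚ k
  f₁′ k = delay (T (1 ℕ.+ s)) k * t ^ℚ k
  regroup : ∀ b g d c e₂ e₁ x₂ x₁ x₀ y₂ y₁ →
    b * x₂ + g * x₁ + d * x₀ + c * e₂ * y₂ + - (c * e₁) * y₁ ≡ b * x₂ + g * x₁ + d * x₀ + c * (e₂ * y₂ - e₁ * y₁)
  regroup = solve-∀ ℚ-ring
  termwise : ∀ k → α S * (T (3 ℕ.+ s) k * t ^ℚ k) ≡ b * f₂ k + g * f₁ k + d * f₀ k + (c * e₂) * f₂′ k + (- (c * e₁)) * f₁′ k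
  termwise k = begin
    α S * (T (3 ℕ.+ s) k * t ^ℚ k) ≡⟨ ℚₚ.*-assoc (α S) (T (3 ℕ.+ s) k) (t ^ℚ k) ⟨
    α S * T (3 ℕ.+ s) k * t ^ℚ k   ≡⟨ cong (_* t ^ℚ k) (certificate s k) ⟩
    (b * T (2 ℕ.+ s) k + g * T (1 ℕ.+ s) k + d * T s k + c * (e₂ * delay (T (2 ℕ.+ s)) k - e₁ * delay (T (1 ℕ.+ s)) k)) * t ^ℚ k
      ≡⟨ distribute b g d c e₂ e₁ (T (2 ℕ.+ s) k) (T (1 ℕ.+ s) k) (T s k) (delay (T (2 ℕ.+ s)) k) (delay (T (1 ℕ.+ s)) k) (t ^ℚ k) ⟩
    b * f₂ k + g * f₁ k + d * f₀ k + (c * e₂) * f₂′ k + (- (c * e₁)) * f₁′ k ∎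
    where
    distribute : ∀ b g d c e₂ e₁ x y z v w p →
      (b * x + g * y + d * z + c * (e₂ * v - e₁ * w)) * p ≡ b * (x * p) + g * (y * p) + d * (z * p) + (c * e₂) * (v * p) + (- (c * e₁)) * (w * p)
    distribute = solve-∀ ℚ-ring

legendreSq≡binomialSum : ∀ t n → legendreSqAtSqrt n (1ℚ + ℕ→ℚ 4 * t) ≡ binomialSum n t
legendreSq≡binomialSum t =
  recurrent-unique (legendreSq-recurrent (1ℚ + ℕ→ℚ 4 * t)) (binomialSum-recurrent t) refl (at₁ t) (at₂ t)
  where
  at₁ : ∀ t → (1ℚ + ℕ→ℚ 4 * t) * 1ℚ * (1ℚ * 1ℚ) ≡ 1ℚ * 1ℚ + ℕ→ℚ 4 * (t * 1ℚ)
  at₁ = solve-∀ ℚ-ring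
  at₂ : ∀ t → 1ℚ * ((1/ ℕ→ℚ 2 * (1/ ℕ→ℚ 2 * 1ℚ) * (ℕ→ℚ 6 * ((1ℚ + ℕ→ℚ 4 * t) * 1ℚ) + (- ℕ→ℚ 2) * 1ℚ))
                  * (1/ ℕ→ℚ 2 * (1/ ℕ→ℚ 2 * 1ℚ) * (ℕ→ℚ 6 * ((1ℚ + ℕ→ℚ 4 * t) * 1ℚ) + (- ℕ→ℚ 2) * 1ℚ)))
    ≡ 1ℚ * 1ℚ + ℕ→ℚ 12 * (t * 1ℚ) + ℕ→ℚ 36 * (t * (t * 1ℚ))
  at₂ = solve-∀ ℚ-ring

sum≡legendreSq[mod-p²] : ∀ n (p-prime : Prime (suc (2 ℕ.* n))) (m : ℚ) .{{_ : NonZero m}} →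
  InZp (suc (2 ℕ.* n)) m → ¬ CongMod (suc (2 ℕ.* n)) 1 m 0ℚ →
  CongMod (suc (2 ℕ.* n)) 2 (sumTo n (λ k → ℕ→ℚ ((2 ℕ.* k) C k) ^ℚ 3 * (1/ m) ^ℚ k)) (legendreSqAtSqrt n (1ℚ - ℕ→ℚ 64 * 1/ m))
sum≡legendreSq[mod-p²] n p-prime m m∈Zp m≢0 =
  subst (CongMod p 2 (sumTo n (λ k → ℕ→ℚ ((2 ℕ.* k) C k) ^ℚ 3 * M ^ℚ k))) (sym legendre≡sum)
    (CongMod-sumTo p-prime {2} n (λ k → ℕ→ℚ ((2 ℕ.* k) C k) ^ℚ 3 * M ^ℚ k) (λ k → binomialTerm n k * t ^ℚ k) termwise)
  where
  p = suc (2 ℕ.* n)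
  M = 1/ m
  t = - ℕ→ℚ 16 * M
  p∤↧M : p ∤ ↧ₙ M
  p∤↧M = ∤↧-1/ p-prime m (λ p∣↥m → m≢0 (p∣↥⇒≡0[mod-p] p-prime m (InZp⇒∤↧ p-prime m m∈Zp) p∣↥m))
  legendre≡sum : legendreSqAtSqrt n (1ℚ - ℕ→ℚ 64 * M) ≡ binomialSum n t
  legendre≡sum = trans (cong (legendreSqAtSqrt n) (rewrite-u M)) (legendreSq≡binomialSum t n)
    where
    rewrite-u : ∀ M → 1ℚ - ℕ→ℚ 64 * M ≡ 1ℚ + ℕ→ℚ 4 * (- ℕ→ℚ 16 * M)
    rewrite-u = solve-∀ ℚ-ring
  termwise : ∀ k → k ℕ.≤ n → CongMod p 2 (ℕ→ℚ ((2 ℕ.* k) C k) ^ℚ 3 * M ^ℚ k) (binomialTerm n k * t ^ℚ k)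
  termwise k k≤n = subst₂ (CongMod p 2) (cube E (M ^ℚ k)) (trans (regroup E (M ^ℚ k) ((- ℕ→ℚ 16) ^ℚ k) B) (cong (B * (E * E) *_) (sym (^ℚ-distribʳ-* (- ℕ→ℚ 16) M k))))
    (CongMod-*ˡ p-prime {2} {E} {(- ℕ→ℚ 16) ^ℚ k * B} (E * E * M ^ℚ k) p∤↧c
      (CongMod-sym p-prime {2} {(- ℕ→ℚ 16) ^ℚ k * B} {E} ([-16]ᵏC[n+k,2k]≡C[2k,k] n p-prime k k≤n)))
    where
    E = ℕ→ℚ ((2 ℕ.* k) C k)
    B = ℕ→ℚ ((n ℕ.+ k) C (2 ℕ.* k))
    p∤↧c : p ∤ ↧ₙ (E * E * M ^ℚ k)
    p∤↧c = ∤↧-* p-prime (E * E) (M ^ℚ k) (∤↧-* p-prime E E (∤↧-ℕ→ℚ p-prime ((2 ℕ.* k) C k)) (∤↧-ℕ→ℚ p-prime ((2 ℕ.* k) C k))) (∤↧-^ p-prime M k p∤↧M)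
    cube : ∀ e w → e * e * w * e ≡ e * (e * (e * 1ℚ)) * w
    cube = solve-∀ ℚ-ring
    regroup : ∀ e w s c → e * e * w * (s * c) ≡ c * (e * e) * (s * w)
    regroup = solve-∀ ℚ-ring

odd-prime : ∀ {p} → Prime p → p ≢ 2 → Σ ℕ (λ n → p ≡ suc (2 ℕ.* n))
odd-prime {p} p-prime p≢2 = by-parity (evenOdd p) p-prime p≢2
  where
  by-parity : ∀ {p} → EvenOdd p → Prime p → p ≢ 2 → Σ ℕ (λ n → p ≡ suc (2 ℕ.* n))
  by-parity (odd n) _ _ = n , refl
  by-parity (even n) p-prime p≢2 with prime⇒irreducible p-prime (divides n (ℕₚ.*-comm 2 n))
  ... | inj₁ ()
  ... | inj₂ 2≡p = ⊥-elim (p≢2 (sym 2≡p))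

theorem3p1 : (p : ℕ) → Prime p → p ≢ 2 →
    (m : ℚ) → .{{_ : NonZero m}} → InZp p m → ¬ CongMod p 1 m 0ℚ →
    CongMod p 2
      (sumTo ((p ∸ 1) / 2) (λ k → (ℕ→ℚ ((2 Data.Nat.* k) C k) ^ℚ 3) * ((1/ m) ^ℚ k)))
      (legendreSqAtSqrt ((p ∸ 1) / 2) (1ℚ - ℕ→ℚ 64 * (1/ m)))
theorem3p1 p p-prime p≢2 m = odd-case (odd-prime p-prime p≢2) p-prime
  where
  odd-case : ∀ {p} → Σ ℕ (λ n → p ≡ suc (2 ℕ.* n)) → Prime p → InZp p m → ¬ CongMod p 1 m 0ℚ →
    CongMod p 2 (sumTo ((p ∸ 1) / 2) (λ k → ℕ→ℚ ((2 ℕ.* k) C k) ^ℚ 3 * (1/ m) ^ℚ k)) (legendreSqAtSqrt ((p ∸ 1) / 2) (1ℚ - ℕ→ℚ 64 * 1/ m))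
  odd-case {p} (n , refl) p-prime m∈Zp m≢0 =
    subst (λ N → CongMod p 2 (sumTo N (λ k → ℕ→ℚ ((2 ℕ.* k) C k) ^ℚ 3 * (1/ m) ^ℚ k)) (legendreSqAtSqrt N (1ℚ - ℕ→ℚ 64 * 1/ m)))
      (sym (2m/2≡m n)) (sum≡legendreSq[mod-p²] n p-prime m m∈Zp m≢0)
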